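{- Let $T$ be a decomposition tree and $v$ an internal node of $T$. Then for every $0\le k\le|\hat{TS}(v)|$, $\hat\gamma_k(v)=\widehat{\min}(v)+\hat\alpha(v)-k$ if $0\le k\le\hat\alpha(v)$; $\hat\gamma_k(v)=\widehat{\min}(v)+k-\hat\beta(v)$ if $\hat\beta(v)\le k\le|\hat{TS}(v)|$; $\hat\gamma_k(v)=\widehat{\min}(v)$ if $\hat\alpha(v)<k<\hat\beta(v)$ and $k-\hat\alpha(v)$ is even; $\hat\gamma_k(v)=\widehat{\min}(v)+1$ otherwise.
   Context: All graphs are finite, simple and undirected. For a graph $H$ and $S\subseteq V(H)$, $N_H[S]$ is the closed neighbourhood of $S$ in $H$ and $H[S]$ the induced subgraph; a graph with no vertices is regarded as having a (empty) perfect matching. A decomposition tree is a rooted tree $T$ in which every internal node has exactly two children, a left child $v_l$ and a right child $v_r$, and carries one of the labels $\otimes$ (true twin), $\odot$ (false twin), $\oplus$ (attachment). To each node $v$ are associated a graph $\hat G(v)$ and a twin set $\hat{TS}(v)\subseteq V(\hat G(v))$: for a leaf, $\hat G(v)$ is a single vertex $x$ (distinct leaves giving distinct vertices) and $\hat{TS}(v)=\{x\}$; for an internal node $v$, $V(\hat G(v))=V(\hat G(v_l))\cup V(\hat G(v_r))$ and: if $v$ is labeled $\otimes$, $E(\hat G(v))=E(\hat G(v_l))\cup E(\hat G(v_r))\cup\{xy: x\in \hat{TS}(v_l), y\in\hat{TS}(v_r)\}$ and $\hat{TS}(v)=\hat{TS}(v_l)\cup\hat{TS}(v_r)$; if labeled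 $\odot$, $E(\hat G(v))=E(\hat G(v_l))\cup E(\hat G(v_r))$ and $\hat{TS}(v)=\hat{TS}(v_l)\cup\hat{TS}(v_r)$; if labeled $\oplus$, the edge set is as for $\otimes$ and $\hat{TS}(v)=\hat{TS}(v_l)$. For $0\le k\le|\hat{TS}(v)|$, $\hat\gamma_k(v)$ is the minimum of $|S|$ over all $S\subseteq V(\hat G(v))$ with $V(\hat G(v))\setminus \hat{TS}(v)\subseteq N_{\hat G(v)}[S]$ for which there is $X\subseteq S\cap\hat{TS}(v)$, $|X|=k$, such that $\hat G(v)[S\setminus X]$ has a perfect matching. Let $\widehat{\min}(v)=\min\{\hat\gamma_k(v):0\le k\le|\hat{TS}(v)|\}$, and let $\hat\alpha(v)$ (resp. $\hat\beta(v)$) be the smallest (resp. largest) $k$ with $\hat\gamma_k(v)=\widehat{\min}(v)$. -}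

module Defs where

open import Data.Nat using (ℕ; zero; suc; _+_; _≤_; _<_)
open import Data.Bool using (Bool; true; false; _∧_; not; if_then_else_; T)
open import Data.Empty using (⊥)
open import Data.Product using (Σ; ∃; _×_; _,_)
open import Data.Sum using (_⊎_)
open import Relation.Binary.PropositionalEquality using (_≡_)
open import Relation.Nullary using (¬_)

-- Node labels: ⊗ (true twin), ⊙ (false twin), ⊕ (attachment)
data Label : Set where
  trueTwin falseTwin attach : Label

data Tree : Set where
  leaf : Tree
  node : Label → Tree → Tree → Tree

-- Vertices of Ĝ(t): the leaves of t (distinct leaves = distinct vertices).
data Vtx : Tree → Set where
  here : Vtx leaf
  inl  : ∀ {c l r} → Vtx l → Vtx (node c l r)
  inr  : ∀ {c l r} → Vtx r → Vtx (node c l r)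

TS : (t : Tree) → Vtx t → Bool
TS leaf here = true
TS (node trueTwin  l r) (inl x) = TS l x
TS (node trueTwin  l r) (inr y) = TS r y
TS (node falseTwin l r) (inl x) = TS l x
TS (node falseTwin l r) (inr y) = TS r y
TS (node attach    l r) (inl x) = TS l x
TS (node attach    l r) (inr y) = false

Edge : (t : Tree) → Vtx t → Vtx t → Set
Edge leaf here here = ⊥
Edge (node c l r) (inl x) (inl y) = Edge l x y
Edge (node c l r) (inr x) (inr y) = Edge r x y
Edge (node trueTwin  l r) (inl x) (inr y) = T (TS l x ∧ TS r y)
Edge (node trueTwin  l r) (inr y) (inl x) = T (TS l x ∧ TS r y)
Edge (node falseTwin l r) (inl x) (inr y) = ⊥
Edge (node falseTwin l r) (inr y) (inl x) = ⊥
Edge (node attach    l r) (inl x) (inr y) = T (TS l x ∧ TS r y)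
Edge (node attach    l r) (inr y) (inl x) = T (TS l x ∧ TS r y)

Subset : Tree → Set
Subset t = Vtx t → Bool

count : (t : Tree) → Subset t → ℕ
count leaf S = if S here then 1 else 0
count (node c l r) S = count l (λ x → S (inl x)) + count r (λ y → S (inr y))

tsSize : Tree → ℕ
tsSize t = count t (TS t)

Dominates : (t : Tree) → Subset t → Set
Dominates t S = ∀ x → TS t x ≡ false →
  ∃ λ y → S y ≡ true × (y ≡ x ⊎ Edge t y x)

-- Ĝ(t)[W] has a perfect matching: a partner function m on W,
-- with each x ∈ W matched to an adjacent partner in W, and m (m x) = x.
-- (Edge is irreflexive, so m x ≠ x.)  W empty gives the empty matching.
PerfectMatching : (t : Tree) → Subset t → Set
PerfectMatching t W = Σ (Vtx t → Vtx t) λ m → ∀ x → W x ≡ true →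
  W (m x) ≡ true × Edge t x (m x) × m (m x) ≡ x

Feasible : (t : Tree) → ℕ → Subset t → Set
Feasible t k S = Dominates t S × Σ (Subset t) λ X →
  (∀ x → X x ≡ true → S x ≡ true × TS t x ≡ true) ×
  count t X ≡ k ×
  PerfectMatching t (λ x → S x ∧ not (X x))

Gamma : (t : Tree) → ℕ → ℕ → Set
Gamma t k n = (Σ (Subset t) λ S → Feasible t k S × count t S ≡ n) ×
              (∀ S → Feasible t k S → n ≤ count t S)

IsMin : (t : Tree) → ℕ → Set
IsMin t μ = (∃ λ k → k ≤ tsSize t × Gamma t k μ) ×
            (∀ k S → k ≤ tsSize t → Feasible t k S → μ ≤ count t S)

IsAlpha : (t : Tree) → ℕ → ℕ → Set
IsAlpha t μ a = a ≤ tsSize t × Gamma t a μ × (∀ k → k < a → ¬ Gamma t k μ)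

IsBeta : (t : Tree) → ℕ → ℕ → Set
IsBeta t μ b = b ≤ tsSize t × Gamma t b μ ×
               (∀ k → b < k → k ≤ tsSize t → ¬ Gamma t k μ)

data Pos : Tree → Set where
  root  : ∀ {t} → Pos t
  left  : ∀ {c l r} → Pos l → Pos (node c l r)
  right : ∀ {c l r} → Pos r → Pos (node c l r)

subtree : (t : Tree) → Pos t → Tree
subtree t root = t
subtree (node c l r) (left p) = subtree l p
subtree (node c l r) (right p) = subtree r p

-- Call (μ, α, β) a profile of a tree if γ̂_k = μ for k = α, α + 2, …, β and
-- γ̂_k ≥ μ + (α − k), γ̂_k ≥ μ + (k − β) for all k.  Two local facts pin γ̂ down from a profile:
-- moving k by one changes γ̂ by at most one (a twin can be traded for a matched neighbour and
-- back), and |S| ≡ k (mod 2) for every admissible S, since S minus the twins is perfectly matched.  An admissible set of a node restricts to admissible sets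
-- of the children, the j pairs matched across the node becoming twins on both sides, and conversely
-- such child sets can be joined.  For ⊙ the profiles add; for ⊗ and ⊕ the new interval is read off
-- from the children's intervals, α being the least number of the parity of μ₁ + μ₂ above
-- max(α₁ − β₂, α₂ − β₁) (resp. α₁ − β₂).

{-# OPTIONS --safe #-}
module Submission where

open import Defs
open import Data.Bool using (Bool; true; false; _∧_; _∨_; not; if_then_else_; T)
open import Data.Bool.Properties using (∧-conicalˡ; ∧-conicalʳ; ∧-zeroʳ; ∧-identityʳ; T?)
import Data.Bool.Properties as Bool
open import Data.Unit using (tt)
open import Data.Nat using (ℕ; zero; suc; _+_; _∸_; _⊔_; _≤_; _<_; _%_; _/_; z≤n; s≤s; z<s; _≤?_)
open import Data.Maybe using (Maybe; just; nothing; is-just; fromMaybe)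
open import Data.Nat.Base using (parity)
open import Data.Nat.Properties
open import Data.Nat.DivMod using (m≡m%n+[m/n]*n)
open import Data.Parity.Base using (Parity; 0ℙ; 1ℙ; _⁻¹) renaming (_+_ to _ℙ+_)
import Data.Parity.Properties as ℙ
open import Algebra.Properties.CommutativeSemigroup +-commutativeSemigroup
  using () renaming (interchange to +-interchange)
open import Data.Product using (Σ; ∃; ∃₂; _×_; _,_; proj₁; proj₂; map₁)
open import Data.Sum using (_⊎_; inj₁; inj₂; [_,_])
open import Data.Nat.Tactic.RingSolver using (solve-∀)
open import Function using (_∘_)
open import Relation.Binary.Definitions using (DecidableEquality)
open import Relation.Binary.PropositionalEquality hiding ([_])
open import Relation.Nullary using (¬_; Dec; yes; no; does; contradiction)
open import Relation.Nullary.Decidable using (toSum; map′; dec-true; dec-false; _×-dec_; _⊎-dec_; _→-dec_)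

inl-injective : ∀ {c l r} {x y : Vtx l} → inl {c} {l} {r} x ≡ inl y → x ≡ y
inl-injective refl = refl

inr-injective : ∀ {c l r} {x y : Vtx r} → inr {c} {l} {r} x ≡ inr y → x ≡ y
inr-injective refl = refl

_≟ᵥ_ : ∀ {t} → DecidableEquality (Vtx t)
here  ≟ᵥ here  = yes refl
inl x ≟ᵥ inl y = map′ (cong inl) inl-injective (x ≟ᵥ y)
inr x ≟ᵥ inr y = map′ (cong inr) inr-injective (x ≟ᵥ y)
inl _ ≟ᵥ inr _ = no λ ()
inr _ ≟ᵥ inl _ = no λ ()

anyVtx? : ∀ t {P : Vtx t → Set} → (∀ x → Dec (P x)) → Dec (∃ P)
anyVtx? leaf         P? = map′ (here ,_) (λ { (here , p) → p }) (P? here)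
anyVtx? (node c l r) P? =
  map′ [ (λ { (x , p) → inl x , p }) , (λ { (y , p) → inr y , p }) ]
       (λ { (inl x , p) → inj₁ (x , p) ; (inr y , p) → inj₂ (y , p) })
       (anyVtx? l (P? ∘ inl) ⊎-dec anyVtx? r (P? ∘ inr))

allVtx? : ∀ t {P : Vtx t → Set} → (∀ x → Dec (P x)) → Dec (∀ x → P x)
allVtx? leaf         P? = map′ (λ { p here → p }) (λ f → f here) (P? here)
allVtx? (node c l r) P? =
  map′ (λ { (f , g) (inl x) → f x ; (f , g) (inr y) → g y }) (λ h → h ∘ inl , h ∘ inr)
       (allVtx? l (P? ∘ inl) ×-dec allVtx? r (P? ∘ inr))

edge? : ∀ t (x y : Vtx t) → Dec (Edge t x y)
edge? leaf here here = no λ ()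
edge? (node c l r)         (inl x) (inl y) = edge? l x y
edge? (node c l r)         (inr x) (inr y) = edge? r x y
edge? (node trueTwin l r)  (inl x) (inr y) = T? _
edge? (node trueTwin l r)  (inr y) (inl x) = T? _
edge? (node falseTwin l r) (inl x) (inr y) = no λ ()
edge? (node falseTwin l r) (inr y) (inl x) = no λ ()
edge? (node attach l r)    (inl x) (inr y) = T? _
edge? (node attach l r)    (inr y) (inl x) = T? _

edge-sym : ∀ t {x y : Vtx t} → Edge t x y → Edge t y x
edge-sym leaf {here} {here} ()
edge-sym (node c l r)         {inl x} {inl y} e = edge-sym l e
edge-sym (node c l r)         {inr x} {inr y} e = edge-sym r e
edge-sym (node trueTwin l r)  {inl x} {inr y} e = e
edge-sym (node trueTwin l r)  {inr y} {inl x} e = e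
edge-sym (node attach l r)    {inl x} {inr y} e = e
edge-sym (node attach l r)    {inr y} {inl x} e = e

edge-irrefl : ∀ t {x : Vtx t} → ¬ Edge t x x
edge-irrefl leaf {here} ()
edge-irrefl (node c l r) {inl x} e = edge-irrefl l e
edge-irrefl (node c l r) {inr x} e = edge-irrefl r e

edge⇒≢ : ∀ t {x y : Vtx t} → Edge t x y → x ≢ y
edge⇒≢ t e refl = edge-irrefl t e

infix  4 _⊆_
infixl 6 _∪_ _∖_

_⊆_ : ∀ {t} → Subset t → Subset t → Set
A ⊆ B = ∀ x → A x ≡ true → B x ≡ true

_∪_ : ∀ {t} → Subset t → Subset t → Subset t
(A ∪ B) x = A x ∨ B x

_∖_ : ∀ {t} → Subset t → Subset t → Subset t
(A ∖ B) x = A x ∧ not (B x)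

∅ : ∀ {t} → Subset t
∅ _ = false

join : ∀ {c l r} → Subset l → Subset r → Subset (node c l r)
join A B (inl x) = A x
join A B (inr y) = B y

∈≢∉ : ∀ {t} (A : Subset t) {u v} → A u ≡ true → A v ≡ false → u ≢ v
∈≢∉ A Au Av refl = contradiction (trans (sym Au) Av) λ ()

⊆-∉ : ∀ {t} {A B : Subset t} {z} → A ⊆ B → B z ≡ false → A z ≡ false
⊆-∉ {A = A} {z = z} A⊆B Bz with A z in Az
... | false = refl
... | true  = contradiction (trans (sym (A⊆B z Az)) Bz) λ ()

update : ∀ {t} → Subset t → Vtx t → Bool → Subset t
update S x b z = if does (z ≟ᵥ x) then b else S z

update-≡ : ∀ {t} (S : Subset t) x b → update S x b x ≡ b
update-≡ S x b rewrite dec-true (x ≟ᵥ x) refl = refl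

update-false-⊆ : ∀ {t} (S : Subset t) y → update S y false ⊆ S
update-false-⊆ S y z S′z with z ≟ᵥ y
... | no _ = S′z

update-cong : ∀ {t} {A B : Subset t} {x b} → A ≗ B → update A x b ≗ update B x b
update-cong {x = x} A≗B z with z ≟ᵥ x
... | yes _ = refl
... | no  _ = A≗B z

update-restore : ∀ {t} (S : Subset t) {x} → S x ≡ true → update (update S x false) x true ≗ S
update-restore S {x} Sx z with z ≟ᵥ x
... | yes refl = sym Sx
... | no  _    = refl

update-≢ : ∀ {t} (S : Subset t) {x z} b → z ≢ x → update S x b z ≡ S z
update-≢ S {x} {z} b z≢x rewrite dec-false (z ≟ᵥ x) z≢x = refl

count-cong : ∀ t {A B : Subset t} → A ≗ B → count t A ≡ count t B
count-cong leaf         A≗B rewrite A≗B here = refl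
count-cong (node c l r) A≗B = cong₂ _+_ (count-cong l (A≗B ∘ inl)) (count-cong r (A≗B ∘ inr))

count-∅ : ∀ t → count t ∅ ≡ 0
count-∅ leaf         = refl
count-∅ (node c l r) = cong₂ _+_ (count-∅ l) (count-∅ r)

count-empty : ∀ t {A : Subset t} → A ≗ ∅ → count t A ≡ 0
count-empty t A≗∅ = trans (count-cong t A≗∅) (count-∅ t)

count≡0⇒empty : ∀ t {A : Subset t} → count t A ≡ 0 → A ≗ ∅
count≡0⇒empty leaf {A} eq here with A here
... | false = refl
count≡0⇒empty (node c l r) {A} eq (inl x) = count≡0⇒empty l (m+n≡0⇒m≡0 _ eq) x
count≡0⇒empty (node c l r) {A} eq (inr y) = count≡0⇒empty r (m+n≡0⇒n≡0 (count l (A ∘ inl)) eq) y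

count-mono : ∀ t {A B : Subset t} → A ⊆ B → count t A ≤ count t B
count-mono leaf {A} {B} A⊆B with A here in a | B here in b
... | false | _     = z≤n
... | true  | true  = ≤-refl
... | true  | false = contradiction (trans (sym (A⊆B here a)) b) λ ()
count-mono (node c l r) A⊆B = +-mono-≤ (count-mono l (A⊆B ∘ inl)) (count-mono r (A⊆B ∘ inr))

count-insert : ∀ t (S : Subset t) x → S x ≡ false → count t (update S x true) ≡ suc (count t S)
count-insert leaf S here Sx rewrite Sx = refl
count-insert (node c l r) S (inl x) Sx =
  cong (_+ count r (S ∘ inr)) (count-insert l (S ∘ inl) x Sx)
count-insert (node c l r) S (inr y) Sy =
  trans (cong (count l (S ∘ inl) +_) (count-insert r (S ∘ inr) y Sy)) (+-suc _ _)

count-delete : ∀ t (S : Subset t) x → S x ≡ true → suc (count t (update S x false)) ≡ count t S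
count-delete leaf S here Sx rewrite Sx = refl
count-delete (node c l r) S (inl x) Sx =
  cong (_+ count r (S ∘ inr)) (count-delete l (S ∘ inl) x Sx)
count-delete (node c l r) S (inr y) Sy =
  trans (sym (+-suc _ _)) (cong (count l (S ∘ inl) +_) (count-delete r (S ∘ inr) y Sy))

count-∪ : ∀ t (A B : Subset t) → (∀ x → A x ≡ true → B x ≡ false) →
  count t (A ∪ B) ≡ count t A + count t B
count-∪ leaf A B disjoint with A here in a | B here in b
... | false | _     = refl
... | true  | false = refl
... | true  | true  = contradiction (trans (sym b) (disjoint here a)) λ ()
count-∪ (node c l r) A B disjoint =
  trans (cong₂ _+_ (count-∪ l _ _ (disjoint ∘ inl)) (count-∪ r _ _ (disjoint ∘ inr)))
        (+-interchange (count l (A ∘ inl)) _ _ _)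

count-<⇒∃ : ∀ t (A B : Subset t) → count t A < count t B → ∃ λ x → B x ≡ true × A x ≡ false
count-<⇒∃ t A B A<B with anyVtx? t (λ x → (B x Bool.≟ true) ×-dec (A x Bool.≟ false))
... | yes found = found
... | no none = contradiction (count-mono t B⊆A) (<⇒≱ A<B)
  where
  B⊆A : B ⊆ A
  B⊆A x Bx with A x in Ax
  ... | true  = refl
  ... | false = contradiction (x , Bx , Ax) none

count>0⇒nonempty : ∀ t (A : Subset t) → 0 < count t A → ∃ λ x → A x ≡ true
count>0⇒nonempty t A pos with count-<⇒∃ t ∅ A (subst (_< count t A) (sym (count-∅ t)) pos)
... | x , Ax , _ = x , Ax

count-split : ∀ t {S X : Subset t} → X ⊆ S → count t S ≡ count t X + count t (S ∖ X)
count-split t {S} {X} X⊆S = trans (count-cong t S≗X∪S∖X) (count-∪ t X (S ∖ X) disjoint)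
  where
  S≗X∪S∖X : S ≗ X ∪ (S ∖ X)
  S≗X∪S∖X x with X x in Xx | S x in Sx
  ... | true  | true  = refl
  ... | true  | false = contradiction (trans (sym (X⊆S x Xx)) Sx) λ ()
  ... | false | b     = sym (∧-identityʳ b)
  disjoint : ∀ x → X x ≡ true → (S ∖ X) x ≡ false
  disjoint x Xx rewrite Xx = ∧-zeroʳ (S x)

Matches : ∀ t → Subset t → (Vtx t → Vtx t) → Set
Matches t W m = ∀ x → W x ≡ true → W (m x) ≡ true × Edge t x (m x) × m (m x) ≡ x

matches-cong : ∀ t {W W′ : Subset t} {m} → W ≗ W′ → Matches t W m → Matches t W′ m
matches-cong t {m = m} W≗W′ M x W′x with M x (trans (W≗W′ x) W′x)
... | Wmx , e , mmx = trans (sym (W≗W′ (m x))) Wmx , e , mmx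

_[_↔_] : ∀ {t} → (Vtx t → Vtx t) → Vtx t → Vtx t → Vtx t → Vtx t
(m [ x ↔ y ]) z = if does (z ≟ᵥ x) then y else if does (z ≟ᵥ y) then x else m z

↔-at-x : ∀ {t} (m : Vtx t → Vtx t) x y → (m [ x ↔ y ]) x ≡ y
↔-at-x m x y rewrite dec-true (x ≟ᵥ x) refl = refl

↔-at-y : ∀ {t} (m : Vtx t → Vtx t) x y → y ≢ x → (m [ x ↔ y ]) y ≡ x
↔-at-y m x y y≢x rewrite dec-false (y ≟ᵥ x) y≢x | dec-true (y ≟ᵥ y) refl = refl

↔-elsewhere : ∀ {t} (m : Vtx t → Vtx t) x y {z} → z ≢ x → z ≢ y → (m [ x ↔ y ]) z ≡ m z
↔-elsewhere m x y {z} z≢x z≢y rewrite dec-false (z ≟ᵥ x) z≢x | dec-false (z ≟ᵥ y) z≢y = refl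

insert₂ : ∀ {t} → Subset t → Vtx t → Vtx t → Subset t
insert₂ W x y = update (update W x true) y true

remove₂ : ∀ {t} → Subset t → Vtx t → Vtx t → Subset t
remove₂ W x y = update (update W x false) y false

insert₂-≢ : ∀ {t} (W : Subset t) {x y z} → z ≢ x → z ≢ y → insert₂ W x y z ≡ W z
insert₂-≢ W {x} z≢x z≢y = trans (update-≢ (update W x true) true z≢y) (update-≢ W true z≢x)

remove₂-≢ : ∀ {t} (W : Subset t) {x y z} → z ≢ x → z ≢ y → remove₂ W x y z ≡ W z
remove₂-≢ W {x} z≢x z≢y = trans (update-≢ (update W x false) false z≢y) (update-≢ W false z≢x)

remove₂-true : ∀ {t} (W : Subset t) x y z → remove₂ W x y z ≡ true → z ≢ x × z ≢ y × W z ≡ true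
remove₂-true W x y z R with z ≟ᵥ y | z ≟ᵥ x
... | yes refl | _        = contradiction R λ ()
... | no z≢y   | yes refl = contradiction R λ ()
... | no z≢y   | no z≢x   = z≢x , z≢y , R

count-remove₂ : ∀ t (W : Subset t) {x y} → W x ≡ true → W y ≡ true → x ≢ y →
  suc (suc (count t (remove₂ W x y))) ≡ count t W
count-remove₂ t W {x} {y} Wx Wy x≢y =
  trans (cong suc (count-delete t (update W x false) y (trans (update-≢ W false (x≢y ∘ sym)) Wy)))
        (count-delete t W x Wx)

matches-insert₂ : ∀ t {W m x y} → Matches t W m → Edge t x y → W x ≡ false → W y ≡ false →
  Matches t (insert₂ W x y) (m [ x ↔ y ])
matches-insert₂ t {W} {m} {x} {y} M xy Wx Wy z Wz with toSum (z ≟ᵥ x) | toSum (z ≟ᵥ y)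
... | inj₁ refl | _ rewrite ↔-at-x m z y | ↔-at-y m z y (edge⇒≢ t xy ∘ sym) =
  update-≡ (update W z true) y true , xy , refl
... | inj₂ z≢x | inj₁ refl rewrite ↔-at-y m x z z≢x | ↔-at-x m x z =
  trans (update-≢ (update W x true) true (z≢x ∘ sym)) (update-≡ W x true) , edge-sym t xy , refl
... | inj₂ z≢x | inj₂ z≢y with M z (trans (sym (insert₂-≢ W z≢x z≢y)) Wz)
... | Wmz , e , mmz rewrite ↔-elsewhere m x y z≢x z≢y
  | ↔-elsewhere m x y (∈≢∉ W Wmz Wx) (∈≢∉ W Wmz Wy) =
  trans (insert₂-≢ W (∈≢∉ W Wmz Wx) (∈≢∉ W Wmz Wy)) Wmz , e , mmz

matches-remove₂ : ∀ t {W m x} → Matches t W m → W x ≡ true → Matches t (remove₂ W x (m x)) m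
matches-remove₂ t {W} {m} {x} M Wx z Rz with remove₂-true W x (m x) z Rz
... | z≢x , z≢mx , Wz with M z Wz
... | Wmz , e , mmz = trans (remove₂-≢ W mz≢x mz≢mx) Wmz , e , mmz
  where
  mz≢x : m z ≢ x
  mz≢x mz≡x = z≢mx (trans (sym mmz) (cong m mz≡x))
  mz≢mx : m z ≢ m x
  mz≢mx mz≡mx = z≢x (trans (sym mmz) (trans (cong m mz≡mx) (proj₂ (proj₂ (M x Wx)))))

matched-count-even : ∀ t {W m} → Matches t W m → ∃ λ h → count t W ≡ h + h
matched-count-even t {W} {m} M = go (count t W) W M refl
  where
  go : ∀ n W → Matches t W m → count t W ≡ n → ∃ λ h → n ≡ h + h
  go zero    W M eq = 0 , refl
  go (suc n) W M eq with count>0⇒nonempty t W (subst (0 <_) (sym eq) z<s)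
  ... | x , Wx with M x Wx
  ... | Wmx , e , _ with n | suc-injective (trans (count-remove₂ t W Wx Wmx (edge⇒≢ t e)) eq)
  ...   | zero   | ()
  ...   | suc n′ | eq′ with go n′ (remove₂ W x (m x)) (matches-remove₂ t M Wx) (suc-injective eq′)
  ...     | h , refl = suc h , cong suc (sym (+-suc h h))

count-involution : ∀ t (m : Vtx t → Vtx t) (P Q : Subset t) →
  (∀ x → P x ≡ true → Q (m x) ≡ true × m (m x) ≡ x) →
  (∀ x → Q x ≡ true → P (m x) ≡ true × m (m x) ≡ x) → count t P ≡ count t Q
count-involution t m P Q P→Q Q→P = go (count t P) P Q P→Q Q→P refl
  where
  go : ∀ n P Q → (∀ x → P x ≡ true → Q (m x) ≡ true × m (m x) ≡ x) →
    (∀ x → Q x ≡ true → P (m x) ≡ true × m (m x) ≡ x) → count t P ≡ n → count t P ≡ count t Q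
  go zero P Q P→Q Q→P eq = trans eq (sym (count-empty t Q-empty))
    where
    Q-empty : Q ≗ ∅
    Q-empty x with Q x in Qx
    ... | false = refl
    ... | true  = contradiction (trans (sym (proj₁ (Q→P x Qx))) (count≡0⇒empty t eq (m x))) λ ()
  go (suc n) P Q P→Q Q→P eq with count>0⇒nonempty t P (subst (0 <_) (sym eq) z<s)
  ... | x , Px = begin
    count t P             ≡⟨ count-delete t P x Px ⟨
    suc (count t P′)      ≡⟨ cong suc (go n P′ Q′ P′→Q′ Q′→P′ (suc-injective (trans (count-delete t P x Px) eq))) ⟩
    suc (count t Q′)      ≡⟨ count-delete t Q (m x) Qmx ⟩
    count t Q             ∎
    where
    open ≡-Reasoning
    Qmx : Q (m x) ≡ true
    Qmx = proj₁ (P→Q x Px)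
    P′ : Subset t
    P′ = update P x false
    Q′ : Subset t
    Q′ = update Q (m x) false
    P′→Q′ : ∀ z → P′ z ≡ true → Q′ (m z) ≡ true × m (m z) ≡ z
    P′→Q′ z P′z with toSum (z ≟ᵥ x)
    ... | inj₁ refl = contradiction (trans (sym P′z) (update-≡ P z false)) λ ()
    ... | inj₂ z≢x with P→Q z (trans (sym (update-≢ P false z≢x)) P′z)
    ...   | Qmz , mmz =
      trans (update-≢ Q false (λ mz≡mx → z≢x (trans (sym mmz) (trans (cong m mz≡mx) (proj₂ (P→Q x Px)))))) Qmz ,
      mmz
    Q′→P′ : ∀ z → Q′ z ≡ true → P′ (m z) ≡ true × m (m z) ≡ z
    Q′→P′ z Q′z with toSum (z ≟ᵥ m x)
    ... | inj₁ refl = contradiction (trans (sym Q′z) (update-≡ Q (m x) false)) λ ()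
    ... | inj₂ z≢mx with Q→P z (trans (sym (update-≢ Q false z≢mx)) Q′z)
    ...   | Pmz , mmz = trans (update-≢ P false (λ mz≡x → z≢mx (trans (sym mmz) (cong m mz≡x)))) Pmz , mmz

parity-double : ∀ h → parity (h + h) ≡ 0ℙ
parity-double h = trans (ℙ.+-homo-+ h h) (ℙ.p+p≡0ℙ (parity h))

parity-+-double : ∀ a h → parity (a + (h + h)) ≡ parity a
parity-+-double a h =
  trans (ℙ.+-homo-+ a (h + h)) (trans (cong (parity a ℙ+_) (parity-double h)) (ℙ.+-identityʳ (parity a)))

parity-suc : ∀ n → parity (suc n) ≡ parity n ⁻¹
parity-suc n = sym (ℙ.⁻¹-selfInverse (ℙ.suc-homo-⁻¹ n))

parity-suc-≢ : ∀ n → parity (suc n) ≢ parity n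
parity-suc-≢ n eq = ℙ.p≢p⁻¹ (parity n) (trans (sym (ℙ.suc-homo-⁻¹ n)) (cong _⁻¹ eq))

double-≤ : ∀ {i d} → i + i ≤ d + d → i ≤ d
double-≤ {zero}              _ = z≤n
double-≤ {suc i} {zero}      ()
double-≤ {suc i} {suc d} (s≤s le) rewrite +-suc i i | +-suc d d = s≤s (double-≤ (≤-pred le))

%2+double : ∀ n → n ≡ n % 2 + (n / 2 + n / 2)
%2+double n =
  trans (m≡m%n+[m/n]*n n 2) (cong (n % 2 +_) (trans (*-comm (n / 2) 2) (cong (n / 2 +_) (+-identityʳ (n / 2)))))

%2≡0⇒double : ∀ n → n % 2 ≡ 0 → ∃ λ h → n ≡ h + h
%2≡0⇒double n even = n / 2 , trans (%2+double n) (cong (_+ (n / 2 + n / 2)) even)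

%2≡1⇒suc-double : ∀ n → n % 2 ≡ 1 → ∃ λ h → n ≡ suc (h + h)
%2≡1⇒suc-double n odd = n / 2 , trans (%2+double n) (cong (_+ (n / 2 + n / 2)) odd)

Matched : ∀ t → ℕ → Subset t → Set
Matched t k S = Σ (Subset t) λ X → (∀ x → X x ≡ true → S x ≡ true × TS t x ≡ true) × count t X ≡ k ×
  PerfectMatching t (S ∖ X)

dominates-⊆ : ∀ t {S S′ : Subset t} → S ⊆ S′ → Dominates t S → Dominates t S′
dominates-⊆ t S⊆S′ dom x x∉TS with dom x x∉TS
... | y , Sy , y↝x = y , S⊆S′ y Sy , y↝x

update-true-⊇ : ∀ {t} (S : Subset t) y → S ⊆ update S y true
update-true-⊇ S y z Sz with z ≟ᵥ y
... | yes _ = refl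
... | no  _ = Sz

feasible-parity : ∀ t {k S} → Feasible t k S → parity (count t S) ≡ parity k
feasible-parity t {k} {S} (_ , X , X⊆ , |X| , m , M) with matched-count-even t M
... | h , |S∖X| = begin
  parity (count t S)                     ≡⟨ cong parity (count-split t (λ x → proj₁ ∘ X⊆ x)) ⟩
  parity (count t X + count t (S ∖ X))   ≡⟨ cong₂ (λ a b → parity (a + b)) |X| |S∖X| ⟩
  parity (k + (h + h))                   ≡⟨ ℙ.+-homo-+ k (h + h) ⟩
  parity k ℙ+ parity (h + h)             ≡⟨ cong (parity k ℙ+_) (parity-double h) ⟩
  parity k ℙ+ 0ℙ                         ≡⟨ ℙ.+-identityʳ (parity k) ⟩
  parity k                               ∎
  where open ≡-Reasoning

matched-cong : ∀ t {k S S′} → S ≗ S′ → Matched t k S → Matched t k S′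
matched-cong t S≗S′ (X , X⊆ , |X| , m , M) =
  X , (λ x Xx → map₁ (λ Sx → trans (sym (S≗S′ x)) Sx) (X⊆ x Xx)) , |X| ,
  m , matches-cong t (λ x → cong (_∧ _) (S≗S′ x)) M

matched-add-pair : ∀ t {k S x y} → Matched t k S → Edge t x y → S x ≡ false → S y ≡ false →
  Matched t k (insert₂ S x y)
matched-add-pair t {S = S} {x} {y} (X , X⊆ , |X| , m , M) xy Sx Sy =
  X , X⊆′ , |X| , _ , matches-cong t S∖X≗ (matches-insert₂ t M xy (cong (_∧ _) Sx) (cong (_∧ _) Sy))
  where
  X⊆′ : ∀ z → X z ≡ true → insert₂ S x y z ≡ true × TS t z ≡ true
  X⊆′ z Xz = map₁ (λ Sz → update-true-⊇ (update S x true) y z (update-true-⊇ S x z Sz)) (X⊆ z Xz)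
  S∖X≗ : insert₂ (S ∖ X) x y ≗ insert₂ S x y ∖ X
  S∖X≗ z with z ≟ᵥ y | z ≟ᵥ x
  ... | yes refl | _        rewrite ⊆-∉ (λ z → proj₁ ∘ X⊆ z) Sy = refl
  ... | no _     | yes refl rewrite ⊆-∉ (λ z → proj₁ ∘ X⊆ z) Sx = refl
  ... | no _     | no _     = refl

matched-add-twin : ∀ t {k S u} → Matched t k S → TS t u ≡ true → S u ≡ false →
  Matched t (suc k) (update S u true)
matched-add-twin t {S = S} {u} (X , X⊆ , |X| , m , M) TSu Su =
  update X u true , X⊆′ , trans (count-insert t X u Xu) (cong suc |X|) , m , matches-cong t S∖X≗ M
  where
  Xu : X u ≡ false
  Xu = ⊆-∉ (λ z → proj₁ ∘ X⊆ z) Su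
  X⊆′ : ∀ z → update X u true z ≡ true → update S u true z ≡ true × TS t z ≡ true
  X⊆′ z X′z with z ≟ᵥ u
  ... | yes refl = refl , TSu
  ... | no _     = X⊆ z X′z
  S∖X≗ : S ∖ X ≗ update S u true ∖ update X u true
  S∖X≗ z with z ≟ᵥ u
  ... | yes refl rewrite Su = refl
  ... | no _     = refl

matched-drop-twin : ∀ t {k S x} → (W : Matched t (suc k) S) → proj₁ W x ≡ true →
  Matched t k (update S x false)
matched-drop-twin t {S = S} {x} (X , X⊆ , |X| , m , M) Xx =
  update X x false , X⊆′ , suc-injective (trans (count-delete t X x Xx) |X|) , m , matches-cong t S∖X≗ M
  where
  X⊆′ : ∀ z → update X x false z ≡ true → update S x false z ≡ true × TS t z ≡ true
  X⊆′ z X′z with z ≟ᵥ x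
  ... | no _ = X⊆ z X′z
  S∖X≗ : S ∖ X ≗ update S x false ∖ update X x false
  S∖X≗ z with z ≟ᵥ x
  ... | yes refl rewrite Xx = ∧-zeroʳ (S z)
  ... | no _     = refl

matched-unpair : ∀ t {k S} (W : Matched t k S) {u} → let (X , _ , _ , m , _) = W in
  (S ∖ X) u ≡ true → TS t u ≡ true → Matched t (suc k) (update S (m u) false)
matched-unpair t {S = S} (X , X⊆ , |X| , m , M) {u} Wu TSu =
  update X u true , X⊆′ , trans (count-insert t X u Xu) (cong suc |X|) , m ,
  matches-cong t S∖X≗ (matches-remove₂ t M Wu)
  where
  Xu : X u ≡ false
  Xu = Bool.not-injective (∧-conicalʳ (S u) _ Wu)
  u≢mu : u ≢ m u
  u≢mu = edge⇒≢ t (proj₁ (proj₂ (M u Wu)))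
  X⊆′ : ∀ z → update X u true z ≡ true → update S (m u) false z ≡ true × TS t z ≡ true
  X⊆′ z X′z with z ≟ᵥ u | z ≟ᵥ m u
  ... | yes refl | yes u≡mu = contradiction u≡mu u≢mu
  ... | yes refl | no _     = ∧-conicalˡ (S u) _ Wu , TSu
  ... | no _     | yes refl = contradiction (subst (λ b → not b ≡ true) X′z (∧-conicalʳ _ _ (proj₁ (M u Wu)))) λ ()
  ... | no _     | no _     = X⊆ z X′z
  S∖X≗ : remove₂ (S ∖ X) u (m u) ≗ update S (m u) false ∖ update X u true
  S∖X≗ z with z ≟ᵥ m u | z ≟ᵥ u
  ... | yes refl | _        = refl
  ... | no _     | yes refl = sym (∧-zeroʳ _)
  ... | no _     | no _     = refl

Achieves : ∀ t → ℕ → ℕ → Set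
Achieves t k n = Σ (Subset t) λ S → Feasible t k S × count t S ≤ n

closed-or-outside-neighbour : ∀ t (S : Subset t) x →
  (∃ λ y → Edge t x y × S y ≡ false) ⊎ (∀ y → Edge t x y → S y ≡ true)
closed-or-outside-neighbour t S x with anyVtx? t (λ y → edge? t x y ×-dec (S y Bool.≟ false))
... | yes found = inj₁ found
... | no none = inj₂ closed
  where
  closed : ∀ y → Edge t x y → S y ≡ true
  closed y xy with S y in Sy
  ... | true  = refl
  ... | false = contradiction (y , xy , Sy) none

dominates-delete : ∀ t {S x} → Dominates t S → (∀ y → Edge t x y → S y ≡ true) →
  (TS t x ≡ false → ∃ λ w → S w ≡ true × w ≢ x × Edge t w x) → Dominates t (update S x false)
dominates-delete t {S} {x} dom N[x]⊆S x-covered z z∉TS with dom z z∉TS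
... | y , Sy , y↝z with y ≟ᵥ x
...   | no y≢x = y , trans (update-≢ S false y≢x) Sy , y↝z
...   | yes refl with y↝z
...     | inj₂ xz = z , trans (update-≢ S false (edge⇒≢ t xz ∘ sym)) (N[x]⊆S z xz) , inj₁ refl
...     | inj₁ refl with x-covered z∉TS
...       | w , Sw , w≢x , wx = w , trans (update-≢ S false w≢x) Sw , inj₂ wx

-- a twin x leaves X: it is matched to a neighbour outside S or, if there is none, dropped
step-down : ∀ t {k S} → Feasible t (suc k) S → Achieves t k (suc (count t S))
step-down t {k} {S} (dom , W@(X , X⊆ , |X| , _)) with count>0⇒nonempty t X (subst (0 <_) (sym |X|) z<s)
... | x , Xx with closed-or-outside-neighbour t S x
... | inj₁ (y , xy , Sy) =
  update S y true ,
  (dominates-⊆ t (update-true-⊇ S y) dom ,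
   matched-cong t (update-cong (update-restore S Sx))
     (matched-add-pair t (matched-drop-twin t W Xx) xy (update-≡ S x false) (trans (update-≢ S false y≢x) Sy))) ,
  ≤-reflexive (count-insert t S y Sy)
  where
  Sx : S x ≡ true
  Sx = proj₁ (X⊆ x Xx)
  y≢x : y ≢ x
  y≢x = edge⇒≢ t xy ∘ sym
... | inj₂ N[x]⊆S =
  update S x false ,
  (dominates-delete t dom N[x]⊆S (λ x∉TS → contradiction (trans (sym (proj₂ (X⊆ x Xx))) x∉TS) λ ()) ,
   matched-drop-twin t W Xx) ,
  ≤-trans (n≤1+n _) (≤-trans (≤-reflexive (count-delete t S x (proj₁ (X⊆ x Xx)))) (n≤1+n _))

-- either a twin outside S is added, or a twin u ∉ X is unmatched from its partner p and joins X;
-- p then joins X too (followed by step-down), is matched to a neighbour outside S, or is dropped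
step-up : ∀ t {k S} → Feasible t k S → k < tsSize t → Achieves t (suc k) (suc (count t S))
step-up t {k} {S} (dom , W@(X , X⊆ , |X| , m , M)) k<|TS|
  with anyVtx? t (λ u → (TS t u Bool.≟ true) ×-dec (S u Bool.≟ false))
... | yes (u , TSu , Su) =
  update S u true , (dominates-⊆ t (update-true-⊇ S u) dom , matched-add-twin t W TSu Su) ,
  ≤-reflexive (count-insert t S u Su)
... | no TS⊆S with count-<⇒∃ t X (TS t) (subst (_< tsSize t) (sym |X|) k<|TS|)
... | u , TSu , Xu = unpaired
  where
  Su : S u ≡ true
  Su with S u in Su
  ... | true  = refl
  ... | false = contradiction (u , TSu , Su) TS⊆S
  Wu : (S ∖ X) u ≡ true
  Wu rewrite Su | Xu = refl
  p : Vtx t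
  p = m u
  up : Edge t u p
  up = proj₁ (proj₂ (M u Wu))
  Sp : S p ≡ true
  Sp = ∧-conicalˡ (S p) _ (proj₁ (M u Wu))
  W′ : Matched t (suc k) (update S p false)
  W′ = matched-unpair t W Wu TSu
  unpaired : Achieves t (suc k) (suc (count t S))
  unpaired with TS t p in TSp | closed-or-outside-neighbour t S p
  ... | true | _ =
    step-down t (dom , matched-cong t (update-restore S Sp) (matched-add-twin t W′ TSp (update-≡ S p false)))
  ... | false | inj₁ (z , pz , Sz) =
    update S z true ,
    (dominates-⊆ t (update-true-⊇ S z) dom ,
     matched-cong t (update-cong (update-restore S Sp))
       (matched-add-pair t W′ pz (update-≡ S p false) (trans (update-≢ S false (edge⇒≢ t pz ∘ sym)) Sz))) ,
    ≤-reflexive (count-insert t S z Sz)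
  ... | false | inj₂ N[p]⊆S =
    update S p false ,
    (dominates-delete t dom N[p]⊆S (λ _ → u , Su , edge⇒≢ t up , up) , W′) ,
    ≤-trans (n≤1+n _) (≤-trans (≤-reflexive (count-delete t S p Sp)) (n≤1+n _))

achieves-≤ : ∀ t {k c c′} → c ≤ c′ → Achieves t k c → Achieves t k c′
achieves-≤ t c≤c′ (S , F , |S|≤c) = S , F , ≤-trans |S|≤c c≤c′

down-by : ∀ t {k c} n → Achieves t (n + k) c → Achieves t k (n + c)
down-by t zero    A = A
down-by t {c = c} (suc n) (S , F , |S|≤c) =
  achieves-≤ t (≤-reflexive (+-suc n c)) (down-by t n (achieves-≤ t (s≤s |S|≤c) (step-down t F)))

up-by : ∀ t {k c} n → n + k ≤ tsSize t → Achieves t k c → Achieves t (n + k) (n + c)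
up-by t zero    _     A = A
up-by t (suc n) bound A with up-by t n (<⇒≤ bound) A
... | S , F , |S|≤c = achieves-≤ t (s≤s |S|≤c) (step-up t F bound)

feasible⇒≤tsSize : ∀ t {k S} → Feasible t k S → k ≤ tsSize t
feasible⇒≤tsSize t (_ , X , X⊆ , |X| , _) = subst (_≤ tsSize t) |X| (count-mono t (λ x → proj₂ ∘ X⊆ x))

feasible⇒≤count : ∀ t {k S} → Feasible t k S → k ≤ count t S
feasible⇒≤count t (_ , X , X⊆ , |X| , _) = subst (_≤ count t _) |X| (count-mono t (λ x → proj₁ ∘ X⊆ x))

LowerBound : ∀ t → ℕ → ℕ → Set
LowerBound t k n = ∀ S → Feasible t k S → n ≤ count t S

gamma-intro : ∀ t {k n} → Achieves t k n → LowerBound t k n → Gamma t k n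
gamma-intro t (S , F , |S|≤n) lower = (S , F , ≤-antisym |S|≤n (lower S F)) , lower

infix 4 _∈⟦_,_⟧

_∈⟦_,_⟧ : ℕ → ℕ → ℕ → Set
n ∈⟦ a , b ⟧ = a ≤ n × n ≤ b × parity n ≡ parity a

record Profile (t : Tree) : Set where
  field
    μ α β    : ℕ
    α≤β      : α ≤ β
    parity-β : parity β ≡ parity α
    achieves : ∀ {n} → n ∈⟦ α , β ⟧ → Achieves t n μ
    above-α  : ∀ k → LowerBound t k (μ + (α ∸ k))
    above-β  : ∀ k → LowerBound t k (μ + (k ∸ β))

  α∈ : α ∈⟦ α , β ⟧
  α∈ = ≤-refl , α≤β , refl

  β∈ : β ∈⟦ α , β ⟧
  β∈ = α≤β , ≤-refl , parity-β

  lower-μ : ∀ k → LowerBound t k μ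
  lower-μ k S F = ≤-trans (m≤m+n μ _) (above-α k S F)

  gamma-between : ∀ {n} → n ∈⟦ α , β ⟧ → Gamma t n μ
  gamma-between n∈ = gamma-intro t (achieves n∈) (lower-μ _)

  parity-μ : parity μ ≡ parity α
  parity-μ with achieves α∈
  ... | S , F , |S|≤μ = trans (cong parity (≤-antisym (lower-μ _ S F) |S|≤μ)) (feasible-parity t F)

  min-unique : ∀ {μ′} → IsMin t μ′ → μ′ ≡ μ
  min-unique ((k , _ , (S , F , |S|≡μ′) , _) , lower′) with achieves α∈
  ... | S₀ , F₀ , |S₀|≤μ =
    ≤-antisym (≤-trans (lower′ _ S₀ (feasible⇒≤tsSize t F₀) F₀) |S₀|≤μ) (subst (μ ≤_) |S|≡μ′ (lower-μ k S F))

  attained⇒between : ∀ {k} → Gamma t k μ → α ≤ k × k ≤ β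
  attained⇒between {k} ((S , F , |S|≡μ) , _) =
    m∸n≡0⇒m≤n (excess≡0 (above-α k S F)) , m∸n≡0⇒m≤n (excess≡0 (above-β k S F))
    where
    excess≡0 : ∀ {e} → μ + e ≤ count t S → e ≡ 0
    excess≡0 μ+e≤ = n≤0⇒n≡0 (+-cancelˡ-≤ μ _ _ (≤-trans μ+e≤ (≤-reflexive (trans |S|≡μ (sym (+-identityʳ μ))))))

  alpha-unique : ∀ {a} → IsAlpha t μ a → a ≡ α
  alpha-unique (_ , Γa , minimal) =
    ≤-antisym (≮⇒≥ (λ α<a → minimal α α<a (gamma-between α∈))) (proj₁ (attained⇒between Γa))

  beta-unique : ∀ {b} → IsBeta t μ b → b ≡ β
  beta-unique (_ , Γb , maximal) =
    ≤-antisym (proj₂ (attained⇒between Γb))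
              (≮⇒≥ (λ b<β → maximal β b<β (feasible⇒≤tsSize t (proj₁ (proj₂ (proj₁ Γβ)))) Γβ))
    where
    Γβ : Gamma t β μ
    Γβ = gamma-between β∈

  gamma-below-α : ∀ {k} → k ≤ α → Gamma t k (μ + (α ∸ k))
  gamma-below-α {k} k≤α =
    gamma-intro t (achieves-≤ t (≤-reflexive (+-comm (α ∸ k) μ)) (down-by t (α ∸ k) A)) (above-α k)
    where
    A : Achieves t ((α ∸ k) + k) μ
    A = subst (λ n → Achieves t n μ) (sym (m∸n+n≡m k≤α)) (achieves α∈)

  gamma-above-β : ∀ {k} → β ≤ k → k ≤ tsSize t → Gamma t k (μ + (k ∸ β))
  gamma-above-β {k} β≤k k≤|TS| =
    gamma-intro t (subst (λ n → Achieves t n (μ + (k ∸ β))) (m∸n+n≡m β≤k)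
                     (achieves-≤ t (≤-reflexive (+-comm (k ∸ β) μ)) (up-by t (k ∸ β) bound (achieves β∈))))
                  (above-β k)
    where
    bound : (k ∸ β) + β ≤ tsSize t
    bound = subst (_≤ tsSize t) (sym (m∸n+n≡m β≤k)) k≤|TS|

  gamma-even-gap : ∀ {k} → α < k → k < β → (k ∸ α) % 2 ≡ 0 → Gamma t k μ
  gamma-even-gap {k} α<k k<β even with %2≡0⇒double (k ∸ α) even
  ... | h , k∸α≡h+h = gamma-between (<⇒≤ α<k , <⇒≤ k<β , parity-k)
    where
    parity-k : parity k ≡ parity α
    parity-k = begin
      parity k              ≡⟨ cong parity (m+[n∸m]≡n (<⇒≤ α<k)) ⟨
      parity (α + (k ∸ α))  ≡⟨ cong (λ e → parity (α + e)) k∸α≡h+h ⟩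
      parity (α + (h + h))  ≡⟨ parity-+-double α h ⟩
      parity α              ∎
      where open ≡-Reasoning

  gamma-odd-gap : ∀ {k} → α < k → k < β → (k ∸ α) % 2 ≡ 1 → k ≤ tsSize t → Gamma t k (suc μ)
  gamma-odd-gap {k} α<k k<β odd k≤|TS| with %2≡1⇒suc-double (k ∸ α) odd
  ... | h , k∸α≡1+h+h = gamma-intro t achieved lower
    where
    n : ℕ
    n = α + (h + h)
    1+n≡k : suc n ≡ k
    1+n≡k = trans (sym (+-suc α (h + h))) (trans (cong (α +_) (sym k∸α≡1+h+h)) (m+[n∸m]≡n (<⇒≤ α<k)))
    n∈ : n ∈⟦ α , β ⟧
    n∈ = m≤m+n α _ , <⇒≤ (<-trans (n<1+n n) (subst (_< β) (sym 1+n≡k) k<β)) , parity-+-double α h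
    achieved : Achieves t k (suc μ)
    achieved with achieves n∈
    ... | S , F , |S|≤μ = subst (λ m → Achieves t m (suc μ)) 1+n≡k
      (achieves-≤ t (s≤s |S|≤μ) (step-up t F (subst (_≤ tsSize t) (sym 1+n≡k) k≤|TS|)))
    lower : LowerBound t k (suc μ)
    lower S F = ≤∧≢⇒< (lower-μ k S F) μ≢|S|
      where
      μ≢|S| : μ ≢ count t S
      μ≢|S| μ≡|S| = parity-suc-≢ n (begin
        parity (suc n)      ≡⟨ cong parity 1+n≡k ⟩
        parity k            ≡⟨ feasible-parity t F ⟨
        parity (count t S)  ≡⟨ cong parity μ≡|S| ⟨
        parity μ            ≡⟨ parity-μ ⟩
        parity α            ≡⟨ parity-+-double α h ⟨
        parity n            ∎)
        where open ≡-Reasoning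

  gamma-profile : ∀ {μ′ a b} → IsMin t μ′ → IsAlpha t μ′ a → IsBeta t μ′ b → ∀ k → k ≤ tsSize t →
    (k ≤ a → Gamma t k (μ′ + (a ∸ k))) × (b ≤ k → Gamma t k (μ′ + (k ∸ b))) ×
    (a < k → k < b → (k ∸ a) % 2 ≡ 0 → Gamma t k μ′) ×
    (a < k → k < b → (k ∸ a) % 2 ≡ 1 → Gamma t k (suc μ′))
  gamma-profile isMin isα isβ k k≤|TS| with min-unique isMin
  ... | refl with alpha-unique isα | beta-unique isβ
  ... | refl | refl =
    gamma-below-α , (λ β≤k → gamma-above-β β≤k k≤|TS|) , gamma-even-gap ,
    (λ α<k k<β odd → gamma-odd-gap α<k k<β odd k≤|TS|)

TS-inl : ∀ c {l r} (x : Vtx l) → TS (node c l r) (inl x) ≡ TS l x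
TS-inl trueTwin  x = refl
TS-inl falseTwin x = refl
TS-inl attach    x = refl

TS-inr : ∀ c {l r} (y : Vtx r) → c ≢ attach → TS (node c l r) (inr y) ≡ TS r y
TS-inr trueTwin  y _ = refl
TS-inr falseTwin y _ = refl
TS-inr attach    y c≢attach = contradiction refl c≢attach

TS-inr-true : ∀ c {l r} (y : Vtx r) → TS (node c l r) (inr y) ≡ true → TS r y ≡ true
TS-inr-true trueTwin  y TSy = TSy
TS-inr-true falseTwin y TSy = TSy

TS-attach-inr : ∀ {c l r} → c ≡ attach → (y : Vtx r) → TS (node c l r) (inr y) ≡ false
TS-attach-inr refl y = refl

TS-inr-false : ∀ c {l r} (y : Vtx r) → TS r y ≡ false → TS (node c l r) (inr y) ≡ false
TS-inr-false trueTwin  y TSy = TSy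
TS-inr-false falseTwin y TSy = TSy
TS-inr-false attach    y _   = refl

T-∧⇒≡ : ∀ {a b} → T (a ∧ b) → a ≡ true × b ≡ true
T-∧⇒≡ {true} {true} _ = refl , refl

≡⇒T-∧ : ∀ {a b} → a ≡ true → b ≡ true → T (a ∧ b)
≡⇒T-∧ refl refl = tt

cross-edge⇒ : ∀ c {l r} {x : Vtx l} {y : Vtx r} → Edge (node c l r) (inl x) (inr y) →
  c ≢ falseTwin × TS l x ≡ true × TS r y ≡ true
cross-edge⇒ trueTwin e = (λ ()) , T-∧⇒≡ e
cross-edge⇒ attach   e = (λ ()) , T-∧⇒≡ e

dominates-inr : ∀ {c l r} {S : Subset (node c l r)} → Dominates r (S ∘ inr) →
  ∀ y → TS r y ≡ false → ∃ λ w → S w ≡ true × (w ≡ inr y ⊎ Edge (node c l r) w (inr y))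
dominates-inr domʳ y y∉TS with domʳ y y∉TS
... | w , Sw , inj₁ refl = inr w , Sw , inj₁ refl
... | w , Sw , inj₂ wy   = inr w , Sw , inj₂ wy

cross-edge : ∀ c {l r} {x : Vtx l} {y : Vtx r} → c ≢ falseTwin → TS l x ≡ true → TS r y ≡ true →
  Edge (node c l r) (inl x) (inr y)
cross-edge trueTwin  _ TSx TSy = ≡⇒T-∧ TSx TSy
cross-edge attach    _ TSx TSy = ≡⇒T-∧ TSx TSy
cross-edge falseTwin c≢falseTwin _ _ = contradiction refl c≢falseTwin

dominates-split : ∀ c {l r} {S : Subset (node c l r)} → Dominates (node c l r) S →
  Dominates l (S ∘ inl) × Dominates r (S ∘ inr)
dominates-split c {l} {r} {S} dom = domˡ , domʳ
  where
  domˡ : Dominates l (S ∘ inl)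
  domˡ x x∉TS with dom (inl x) (trans (TS-inl c x) x∉TS)
  ... | inl w , Sw , inj₁ refl = w , Sw , inj₁ refl
  ... | inl w , Sw , inj₂ wx   = w , Sw , inj₂ wx
  ... | inr w , Sw , inj₂ wx   =
    contradiction (trans (sym (proj₁ (proj₂ (cross-edge⇒ c (edge-sym (node c l r) {inr w} {inl x} wx))))) x∉TS) λ ()
  domʳ : Dominates r (S ∘ inr)
  domʳ y y∉TS with dom (inr y) (TS-inr-false c y y∉TS)
  ... | inr w , Sw , inj₁ refl = w , Sw , inj₁ refl
  ... | inr w , Sw , inj₂ wy   = w , Sw , inj₂ wy
  ... | inl w , Sw , inj₂ wy   = contradiction (trans (sym (proj₂ (proj₂ (cross-edge⇒ c wy)))) y∉TS) λ ()

dominates-join : ∀ c {l r} {S : Subset (node c l r)} →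
  Dominates l (S ∘ inl) → Dominates r (S ∘ inr) →
  (c ≡ attach → ∃ λ x → S (inl x) ≡ true × TS l x ≡ true) → Dominates (node c l r) S
dominates-join c domˡ domʳ _ (inl x) x∉TS with domˡ x (trans (sym (TS-inl c x)) x∉TS)
... | w , Sw , inj₁ refl = inl w , Sw , inj₁ refl
... | w , Sw , inj₂ wx   = inl w , Sw , inj₂ wx
dominates-join trueTwin  domˡ domʳ _ (inr y) y∉TS = dominates-inr domʳ y y∉TS
dominates-join falseTwin domˡ domʳ _ (inr y) y∉TS = dominates-inr domʳ y y∉TS
dominates-join attach {r = r} domˡ domʳ twinˡ (inr y) _ with TS r y in TSy
... | false = dominates-inr domʳ y TSy
... | true  with twinˡ refl
...   | x , Sx , TSx = inl x , Sx , inj₂ (≡⇒T-∧ TSx TSy)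

module Restriction {t s : Tree} (ι : Vtx s → Vtx t) (π : Vtx t → Maybe (Vtx s))
  (π∘ι : ∀ x → π (ι x) ≡ just x) (ι∘π : ∀ {z x} → π z ≡ just x → ι x ≡ z)
  (edge-reflect : ∀ {x y} → Edge t (ι x) (ι y) → Edge s x y) where

  stays : (Vtx t → Vtx t) → Subset s
  stays m x = is-just (π (m (ι x)))

  restrict : (Vtx t → Vtx t) → Vtx s → Vtx s
  restrict m x = fromMaybe x (π (m (ι x)))

  matches-restrict : ∀ {W m} → Matches t W m → Matches s (λ x → W (ι x) ∧ stays m x) (restrict m)
  matches-restrict {W} {m} M x Wx with π (m (ι x)) in πmx
  ... | nothing = contradiction (trans (sym Wx) (∧-zeroʳ (W (ι x)))) λ ()
  ... | just y with M (ι x) (∧-conicalˡ _ _ Wx)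
  ...   | Wmx , e , mmx rewrite sym (ι∘π πmx) | mmx | π∘ι x =
    trans (∧-identityʳ _) Wmx , edge-reflect e , refl

  -- vertices of s matched outside s; in s they have to become twins
  crossing : Subset t → (Vtx t → Vtx t) → Subset s
  crossing W m x = W (ι x) ∧ not (stays m x)

  matched-restrict : ∀ {k S} ((X , _ , _ , m , _) : Matched t k S) →
    (∀ x → X (ι x) ≡ true → TS s x ≡ true) →
    (∀ x → crossing (S ∖ X) m x ≡ true → TS s x ≡ true) →
    Matched s (count s (X ∘ ι) + count s (crossing (S ∖ X) m)) (S ∘ ι)
  matched-restrict {S = S} (X , X⊆ , _ , m , M) X-TS crossing-TS =
    X′ , X′⊆ , count-∪ s (X ∘ ι) (crossing (S ∖ X) m) disjoint , restrict m ,
    matches-cong s S∖X≗ (matches-restrict M)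
    where
    X′ : Subset s
    X′ = (X ∘ ι) ∪ crossing (S ∖ X) m
    disjoint : ∀ x → X (ι x) ≡ true → crossing (S ∖ X) m x ≡ false
    disjoint x Xx rewrite Xx | ∧-zeroʳ (S (ι x)) = refl
    X′⊆ : ∀ x → X′ x ≡ true → S (ι x) ≡ true × TS s x ≡ true
    X′⊆ x X′x with X (ι x) in Xx
    ... | true  = proj₁ (X⊆ (ι x) Xx) , X-TS x Xx
    ... | false = trans (sym (∧-identityʳ _)) (∧-conicalˡ _ _ X′x) ,
                  crossing-TS x (subst (λ b → (S (ι x) ∧ not b) ∧ _ ≡ true) (sym Xx) X′x)
    S∖X≗ : ∀ x → (S (ι x) ∧ not (X (ι x))) ∧ stays m x ≡ (S ∘ ι ∖ X′) x
    S∖X≗ x = split (S (ι x)) (X (ι x)) (stays m x)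
      where
      split : ∀ a b c → (a ∧ not b) ∧ c ≡ a ∧ not (b ∨ ((a ∧ not b) ∧ not c))
      split false b     c     = refl
      split true  true  c     = refl
      split true  false true  = refl
      split true  false false = refl

fromLeft : ∀ {c l r} → Vtx (node c l r) → Maybe (Vtx l)
fromLeft (inl x) = just x
fromLeft (inr _) = nothing

fromRight : ∀ {c l r} → Vtx (node c l r) → Maybe (Vtx r)
fromRight (inl _) = nothing
fromRight (inr y) = just y

fromLeft-just : ∀ {c l r} {z : Vtx (node c l r)} {x} → fromLeft z ≡ just x → inl x ≡ z
fromLeft-just {z = inl x} refl = refl

fromRight-just : ∀ {c l r} {z : Vtx (node c l r)} {y} → fromRight z ≡ just y → inr y ≡ z
fromRight-just {z = inr y} refl = refl

module Left  {c l r} = Restriction {node c l r} inl fromLeft  (λ _ → refl) fromLeft-just  (λ e → e)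
module Right {c l r} = Restriction {node c l r} inr fromRight (λ _ → refl) fromRight-just (λ e → e)

record Split c l r (k : ℕ) (S : Subset (node c l r)) : Set where
  field
    j xl xr         : ℕ
    k≡xl+xr         : k ≡ xl + xr
    feasibleˡ       : Feasible l (xl + j) (S ∘ inl)
    feasibleʳ       : Feasible r (xr + j) (S ∘ inr)
    falseTwin⇒j≡0   : c ≡ falseTwin → j ≡ 0
    attach⇒xr≡0     : c ≡ attach → xr ≡ 0

module _ {c l r} {W : Subset (node c l r)} {m} (M : Matches (node c l r) W m) where

  crossingˡ-partner : ∀ x → Left.crossing W m x ≡ true → ∃ λ y → m (inl x) ≡ inr y × Edge (node c l r) (inl x) (inr y)
  crossingˡ-partner x cx with m (inl x) in mx
  ... | inr y = y , refl , subst (Edge _ (inl x)) mx (proj₁ (proj₂ (M (inl x) (∧-conicalˡ _ _ cx))))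
  ... | inl _ = contradiction (trans (sym cx) (∧-zeroʳ _)) λ ()

  crossingʳ-partner : ∀ y → Right.crossing W m y ≡ true → ∃ λ x → m (inr y) ≡ inl x × Edge (node c l r) (inl x) (inr y)
  crossingʳ-partner y cy with m (inr y) in my
  ... | inl x = x , refl ,
    edge-sym (node c l r) {inr y} {inl x} (subst (Edge _ (inr y)) my (proj₁ (proj₂ (M (inr y) (∧-conicalˡ _ _ cy)))))
  ... | inr _ = contradiction (trans (sym cy) (∧-zeroʳ _)) λ ()

  crossing-balanced : count l (Left.crossing W m) ≡ count r (Right.crossing W m)
  crossing-balanced = begin
    count l crossˡ                      ≡⟨ +-identityʳ _ ⟨
    count l crossˡ + 0                  ≡⟨ cong (count l crossˡ +_) (count-∅ r) ⟨
    count (node c l r) (join crossˡ ∅)  ≡⟨ count-involution (node c l r) m _ _ left→right right→left ⟩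
    count (node c l r) (join ∅ crossʳ)  ≡⟨ cong (_+ count r crossʳ) (count-∅ l) ⟩
    count r crossʳ                      ∎
    where
    open ≡-Reasoning
    crossˡ : Subset l
    crossˡ = Left.crossing W m
    crossʳ : Subset r
    crossʳ = Right.crossing W m
    left→right : ∀ z → join crossˡ ∅ z ≡ true → join ∅ crossʳ (m z) ≡ true × m (m z) ≡ z
    left→right (inl x) cx with crossingˡ-partner x cx | M (inl x) (∧-conicalˡ _ _ cx)
    ... | y , mx≡y , _ | Wmx , _ , mmx rewrite mx≡y | mmx = trans (∧-identityʳ _) Wmx , refl
    right→left : ∀ z → join ∅ crossʳ z ≡ true → join crossˡ ∅ (m z) ≡ true × m (m z) ≡ z
    right→left (inr y) cy with crossingʳ-partner y cy | M (inr y) (∧-conicalˡ _ _ cy)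
    ... | x , my≡x , _ | Wmy , _ , mmy rewrite my≡x | mmy = trans (∧-identityʳ _) Wmy , refl

decompose : ∀ c {l r k S} → Feasible (node c l r) k S → Split c l r k S
decompose c {l} {r} {k} {S} (dom , W@(X , X⊆ , |X| , m , M)) = record
  { j             = count l (Left.crossing (S ∖ X) m)
  ; xl            = count l (X ∘ inl)
  ; xr            = count r (X ∘ inr)
  ; k≡xl+xr       = sym |X|
  ; feasibleˡ     = proj₁ (dominates-split c dom) , Left.matched-restrict W X-TSˡ crossing-TSˡ
  ; feasibleʳ     = proj₂ (dominates-split c dom) ,
                    subst (λ j → Matched r (count r (X ∘ inr) + j) (S ∘ inr)) (sym (crossing-balanced M))
                          (Right.matched-restrict W X-TSʳ crossing-TSʳ)
  ; falseTwin⇒j≡0 = count-empty l ∘ no-crossing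
  ; attach⇒xr≡0   = count-empty r ∘ no-right-twins
  }
  where
  X-TSˡ : ∀ x → X (inl x) ≡ true → TS l x ≡ true
  X-TSˡ x Xx = trans (sym (TS-inl c x)) (proj₂ (X⊆ (inl x) Xx))
  X-TSʳ : ∀ y → X (inr y) ≡ true → TS r y ≡ true
  X-TSʳ y Xy = TS-inr-true c y (proj₂ (X⊆ (inr y) Xy))
  crossing-TSˡ : ∀ x → Left.crossing (S ∖ X) m x ≡ true → TS l x ≡ true
  crossing-TSˡ x cx = proj₁ (proj₂ (cross-edge⇒ c (proj₂ (proj₂ (crossingˡ-partner M x cx)))))
  crossing-TSʳ : ∀ y → Right.crossing (S ∖ X) m y ≡ true → TS r y ≡ true
  crossing-TSʳ y cy = proj₂ (proj₂ (cross-edge⇒ c (proj₂ (proj₂ (crossingʳ-partner M y cy)))))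
  no-crossing : c ≡ falseTwin → Left.crossing (S ∖ X) m ≗ ∅
  no-crossing c≡falseTwin x with Left.crossing (S ∖ X) m x in cx
  ... | false = refl
  ... | true  = contradiction c≡falseTwin (proj₁ (cross-edge⇒ c (proj₂ (proj₂ (crossingˡ-partner M x cx)))))
  no-right-twins : c ≡ attach → X ∘ inr ≗ ∅
  no-right-twins c≡attach y with X (inr y) in Xy
  ... | false = refl
  ... | true  = contradiction (trans (sym (proj₂ (X⊆ (inr y) Xy))) (TS-attach-inr c≡attach y)) λ ()

matches-release₂ : ∀ t {S X : Subset t} {m x y} → Matches t (S ∖ X) m → X ⊆ S → X x ≡ true → X y ≡ true →
  Edge t x y → Matches t (S ∖ remove₂ X x y) (m [ x ↔ y ])
matches-release₂ t {S} {X} {m} {x} {y} M X⊆S Xx Xy xy =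
  matches-cong t S∖X≗ (matches-insert₂ t M xy (∖-out Xx) (∖-out Xy))
  where
  ∖-out : ∀ {z} → X z ≡ true → (S ∖ X) z ≡ false
  ∖-out {z} Xz rewrite Xz = ∧-zeroʳ (S z)
  S∖X≗ : insert₂ (S ∖ X) x y ≗ S ∖ remove₂ X x y
  S∖X≗ z with z ≟ᵥ y | z ≟ᵥ x
  ... | yes refl | _        = sym (trans (∧-identityʳ (S z)) (X⊆S z Xy))
  ... | no _     | yes refl = sym (trans (∧-identityʳ (S z)) (X⊆S z Xx))
  ... | no _     | no _     = refl

-- the twin part is drawn from the twins of both children, a of them on the left and b on the
-- right; for ⊕ the twins of r are not twins of the node, so this is not a Matched configuration
Matched₂ : ∀ c l r → Subset (node c l r) → ℕ → ℕ → Set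
Matched₂ c l r S a b = Σ (Subset (node c l r)) λ X → X ⊆ S ×
  (∀ x → X (inl x) ≡ true → TS l x ≡ true) × (∀ y → X (inr y) ≡ true → TS r y ≡ true) ×
  count l (X ∘ inl) ≡ a × count r (X ∘ inr) ≡ b × PerfectMatching (node c l r) (S ∖ X)

matched₂-join : ∀ {c l r S a b} → Matched l a (S ∘ inl) → Matched r b (S ∘ inr) → Matched₂ c l r S a b
matched₂-join {c} {l} {r} {S} (Xl , Xl⊆ , |Xl| , ml , Ml) (Xr , Xr⊆ , |Xr| , mr , Mr) =
  join Xl Xr , X⊆S , (λ x → proj₂ ∘ Xl⊆ x) , (λ y → proj₂ ∘ Xr⊆ y) , |Xl| , |Xr| , m , M
  where
  X⊆S : join Xl Xr ⊆ S
  X⊆S (inl x) = proj₁ ∘ Xl⊆ x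
  X⊆S (inr y) = proj₁ ∘ Xr⊆ y
  m : Vtx (node c l r) → Vtx (node c l r)
  m (inl x) = inl (ml x)
  m (inr y) = inr (mr y)
  M : Matches (node c l r) (S ∖ join Xl Xr) m
  M (inl x) Wx with Ml x Wx
  ... | Wmx , e , mmx = Wmx , e , cong inl mmx
  M (inr y) Wy with Mr y Wy
  ... | Wmy , e , mmy = Wmy , e , cong inr mmy

matched₂-pair : ∀ {c l r S a b} → c ≢ falseTwin → Matched₂ c l r S (suc a) (suc b) → Matched₂ c l r S a b
matched₂-pair {c} {l} {r} {S} c≢falseTwin (X , X⊆S , TSˡ , TSʳ , |Xˡ| , |Xʳ| , m , M)
  with count>0⇒nonempty l (X ∘ inl) (subst (0 <_) (sym |Xˡ|) z<s)
     | count>0⇒nonempty r (X ∘ inr) (subst (0 <_) (sym |Xʳ|) z<s)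
... | x , Xx | y , Xy =
  remove₂ X (inl x) (inr y) , (λ z → X⊆S z ∘ proj₂ ∘ proj₂ ∘ remove₂-true X (inl x) (inr y) z) ,
  (λ u → TSˡ u ∘ proj₂ ∘ proj₂ ∘ remove₂-true X (inl x) (inr y) (inl u)) ,
  (λ u → TSʳ u ∘ proj₂ ∘ proj₂ ∘ remove₂-true X (inl x) (inr y) (inr u)) ,
  suc-injective (trans (count-delete l (X ∘ inl) x Xx) |Xˡ|) ,
  suc-injective (trans (count-delete r (X ∘ inr) y Xy) |Xʳ|) ,
  _ , matches-release₂ (node c l r) M X⊆S Xx Xy (cross-edge c c≢falseTwin (TSˡ x Xx) (TSʳ y Xy))

matched₂-pairs : ∀ {c l r S a b} j → (c ≡ falseTwin → j ≡ 0) →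
  Matched₂ c l r S (a + j) (b + j) → Matched₂ c l r S a b
matched₂-pairs {a = a} {b} zero _ W = subst₂ (Matched₂ _ _ _ _) (+-identityʳ a) (+-identityʳ b) W
matched₂-pairs {a = a} {b} (suc j) j≡0 W =
  matched₂-pairs j (λ c≡f → contradiction (j≡0 c≡f) λ ())
    (matched₂-pair (λ c≡f → contradiction (j≡0 c≡f) λ ()) (subst₂ (Matched₂ _ _ _ _) (+-suc a j) (+-suc b j) W))

matched₂⇒matched : ∀ {c l r S a b} → (c ≡ attach → b ≡ 0) → Matched₂ c l r S a b →
  Matched (node c l r) (a + b) S
matched₂⇒matched {c} {l} {r} {S} {a} {b} b≡0 (X , X⊆S , TSˡ , TSʳ , |Xˡ| , |Xʳ| , PM) =
  X , X⊆ , cong₂ _+_ |Xˡ| |Xʳ| , PM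
  where
  X⊆ : ∀ z → X z ≡ true → S z ≡ true × TS (node c l r) z ≡ true
  X⊆ (inl x) Xx = X⊆S (inl x) Xx , trans (TS-inl c x) (TSˡ x Xx)
  X⊆ (inr y) Xy = X⊆S (inr y) Xy , trans (TS-inr c y c≢attach) (TSʳ y Xy)
    where
    c≢attach : c ≢ attach
    c≢attach c≡attach = contradiction (trans (sym Xy) (count≡0⇒empty r (trans |Xʳ| (b≡0 c≡attach)) y)) λ ()

compose : ∀ c {l r k S} (sp : Split c l r k S) → (c ≡ attach → 0 < Split.xl sp + Split.j sp) →
  Feasible (node c l r) k S
compose c {l} {r} {S = S} sp nonempty =
  dominates-join c (proj₁ feasibleˡ) (proj₁ feasibleʳ) twinˡ ,
  subst (λ k → Matched (node c l r) k S) (sym k≡xl+xr)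
    (matched₂⇒matched attach⇒xr≡0
      (matched₂-pairs j falseTwin⇒j≡0 (matched₂-join (proj₂ feasibleˡ) (proj₂ feasibleʳ))))
  where
  open Split sp
  twinˡ : c ≡ attach → ∃ λ x → S (inl x) ≡ true × TS l x ≡ true
  twinˡ c≡attach with proj₂ feasibleˡ
  ... | X , X⊆ , |X| , _ with count>0⇒nonempty l X (subst (0 <_) (sym |X|) (nonempty c≡attach))
  ...   | x , Xx = x , X⊆ x Xx

parity≡0⇒double : ∀ n → parity n ≡ 0ℙ → ∃ λ h → n ≡ h + h
parity≡0⇒double zero          _  = 0 , refl
parity≡0⇒double (suc (suc n)) eq with parity≡0⇒double n eq
... | h , refl = suc h , cong suc (sym (+-suc h h))

[p+q]+q≡p : ∀ p q → (p ℙ+ q) ℙ+ q ≡ p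
[p+q]+q≡p 0ℙ 0ℙ = refl
[p+q]+q≡p 0ℙ 1ℙ = refl
[p+q]+q≡p 1ℙ 0ℙ = refl
[p+q]+q≡p 1ℙ 1ℙ = refl

[p+q]+p≡q : ∀ p q → (p ℙ+ q) ℙ+ p ≡ q
[p+q]+p≡q p q = trans (cong (_ℙ+ p) (ℙ.+-comm p q)) ([p+q]+q≡p q p)

p+[p+q]≡q : ∀ p q → p ℙ+ (p ℙ+ q) ≡ q
p+[p+q]≡q p q = trans (ℙ.+-comm p (p ℙ+ q)) ([p+q]+p≡q p q)

[p+q]+[q+p]≡0ℙ : ∀ a b → (a ℙ+ b) ℙ+ (b ℙ+ a) ≡ 0ℙ
[p+q]+[q+p]≡0ℙ 0ℙ 0ℙ = refl
[p+q]+[q+p]≡0ℙ 0ℙ 1ℙ = refl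
[p+q]+[q+p]≡0ℙ 1ℙ 0ℙ = refl
[p+q]+[q+p]≡0ℙ 1ℙ 1ℙ = refl

≢⇒⁻¹≡ : ∀ {p q : Parity} → p ≢ q → p ⁻¹ ≡ q
≢⇒⁻¹≡ {0ℙ} {0ℙ} p≢q = contradiction refl p≢q
≢⇒⁻¹≡ {0ℙ} {1ℙ} _   = refl
≢⇒⁻¹≡ {1ℙ} {0ℙ} _   = refl
≢⇒⁻¹≡ {1ℙ} {1ℙ} p≢q = contradiction refl p≢q

parity-∸ : ∀ {a b} → b ≤ a → parity (a ∸ b) ≡ parity a ℙ+ parity b
parity-∸ {a} {b} b≤a = begin
  parity (a ∸ b)                            ≡⟨ [p+q]+q≡p (parity (a ∸ b)) (parity b) ⟨
  (parity (a ∸ b) ℙ+ parity b) ℙ+ parity b  ≡⟨ cong (_ℙ+ parity b) (ℙ.+-homo-+ (a ∸ b) b) ⟨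
  parity ((a ∸ b) + b) ℙ+ parity b          ≡⟨ cong (λ n → parity n ℙ+ parity b) (m∸n+n≡m b≤a) ⟩
  parity a ℙ+ parity b                      ∎
  where open ≡-Reasoning

record LeastAbove (m : ℕ) (p : Parity) : Set where
  field
    value        : ℕ
    m≤value      : m ≤ value
    parity-value : parity value ≡ p
    least        : ∀ {n} → m ≤ n → parity n ≡ p → value ≤ n

least-above : ∀ m p → LeastAbove m p
least-above m p with parity m ℙ.≟ p
... | yes parity-m = record { value = m ; m≤value = ≤-refl ; parity-value = parity-m ; least = λ m≤n _ → m≤n }
... | no  parity-m = record
  { value        = suc m
  ; m≤value      = n≤1+n m
  ; parity-value = trans (parity-suc m) (≢⇒⁻¹≡ parity-m)
  ; least        = λ m≤n parity-n → ≤∧≢⇒< m≤n λ { refl → parity-m parity-n }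
  }

-- u + v - n is even and at most 2u and 2v, so half of it can be taken from each of u and v
pair-off : ∀ {n u v} → n ≤ u + v → v ≤ n + u → u ≤ n + v → parity n ≡ parity (u + v) →
  ∃ λ j → j ≤ u × j ≤ v × (u ∸ j) + (v ∸ j) ≡ n
pair-off {n} {u} {v} n≤u+v v≤n+u u≤n+v parity-n with parity≡0⇒double ((u + v) ∸ n) even
  where
  even : parity ((u + v) ∸ n) ≡ 0ℙ
  even = trans (parity-∸ n≤u+v) (trans (cong (parity (u + v) ℙ+_) parity-n) (ℙ.p+p≡0ℙ (parity (u + v))))
... | j , w≡j+j = j , j≤u , double-≤ j+j≤v+v , sum
  where
  open ≤-Reasoning
  j+j≤u+u : j + j ≤ u + u
  j+j≤u+u = subst (_≤ u + u) w≡j+j (m≤n+o⇒m∸n≤o (u + v) n (begin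
    u + v        ≤⟨ +-monoʳ-≤ u v≤n+u ⟩
    u + (n + u)  ≡⟨ +-comm u (n + u) ⟩
    n + u + u    ≡⟨ +-assoc n u u ⟩
    n + (u + u)  ∎))
  j≤u : j ≤ u
  j≤u = double-≤ j+j≤u+u
  j+j≤v+v : j + j ≤ v + v
  j+j≤v+v = subst (_≤ v + v) w≡j+j (m≤n+o⇒m∸n≤o (u + v) n (begin
    u + v        ≤⟨ +-monoˡ-≤ v u≤n+v ⟩
    n + v + v    ≡⟨ +-assoc n v v ⟩
    n + (v + v)  ∎))
  sum : (u ∸ j) + (v ∸ j) ≡ n
  sum = +-cancelʳ-≡ (j + j) _ _ (begin-equality
    (u ∸ j) + (v ∸ j) + (j + j)    ≡⟨ +-interchange (u ∸ j) (v ∸ j) j j ⟩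
    (u ∸ j + j) + (v ∸ j + j)      ≡⟨ cong₂ _+_ (m∸n+n≡m j≤u) (m∸n+n≡m (double-≤ {j} {v} j+j≤v+v)) ⟩
    u + v                          ≡⟨ m+[n∸m]≡n n≤u+v ⟨
    n + ((u + v) ∸ n)              ≡⟨ cong (n +_) w≡j+j ⟩
    n + (j + j)                    ∎)

sum-split : ∀ {n α₁ β₁ α₂ β₂} → α₁ ≤ β₁ → α₂ ≤ β₂ → parity β₁ ≡ parity α₁ → n ∈⟦ α₁ + α₂ , β₁ + β₂ ⟧ →
  ∃₂ λ u v → u ∈⟦ α₁ , β₁ ⟧ × v ∈⟦ α₂ , β₂ ⟧ × u + v ≡ n
sum-split {n} {α₁} {β₁} {α₂} {β₂} α₁≤β₁ α₂≤β₂ parity-β₁ (α≤n , n≤β , parity-n) with n ∸ α₂ ≤? β₁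
... | yes n∸α₂≤β₁ =
  n ∸ α₂ , α₂ , (m+n≤o⇒m≤o∸n α₁ α≤n , n∸α₂≤β₁ , parity-u) , (≤-refl , α₂≤β₂ , refl) , m∸n+n≡m α₂≤n
  where
  α₂≤n : α₂ ≤ n
  α₂≤n = ≤-trans (m≤n+m α₂ α₁) α≤n
  parity-u : parity (n ∸ α₂) ≡ parity α₁
  parity-u = trans (parity-∸ α₂≤n)
    (trans (cong (_ℙ+ parity α₂) (trans parity-n (ℙ.+-homo-+ α₁ α₂))) ([p+q]+q≡p _ _))
... | no n∸α₂≰β₁ =
  β₁ , n ∸ β₁ , (α₁≤β₁ , ≤-refl , parity-β₁) , (α₂≤n∸β₁ , m≤n+o⇒m∸n≤o n β₁ n≤β , parity-v) , m+[n∸m]≡n β₁≤n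
  where
  α₂≤n : α₂ ≤ n
  α₂≤n = ≤-trans (m≤n+m α₂ α₁) α≤n
  β₁+α₂≤n : β₁ + α₂ ≤ n
  β₁+α₂≤n = m≤o∸n⇒m+n≤o β₁ α₂≤n (<⇒≤ (≰⇒> n∸α₂≰β₁))
  β₁≤n : β₁ ≤ n
  β₁≤n = ≤-trans (m≤m+n β₁ α₂) β₁+α₂≤n
  α₂≤n∸β₁ : α₂ ≤ n ∸ β₁
  α₂≤n∸β₁ = m+n≤o⇒m≤o∸n α₂ (subst (_≤ n) (+-comm β₁ α₂) β₁+α₂≤n)
  parity-v : parity (n ∸ β₁) ≡ parity α₂
  parity-v = trans (parity-∸ β₁≤n)
    (trans (cong₂ _ℙ+_ (trans parity-n (ℙ.+-homo-+ α₁ α₂)) parity-β₁) ([p+q]+p≡q (parity α₁) _))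

twin-split : ∀ {n α₁ β₁ α₂ β₂} → α₁ ≤ β₁ → α₂ ≤ β₂ → parity β₁ ≡ parity α₁ → parity β₂ ≡ parity α₂ →
  n ≤ β₁ + β₂ → α₁ ≤ n + β₂ → α₂ ≤ n + β₁ → parity n ≡ parity (α₁ + α₂) →
  ∃₂ λ u v → u ∈⟦ α₁ , β₁ ⟧ × v ∈⟦ α₂ , β₂ ⟧ × ∃ λ j → j ≤ u × j ≤ v × (u ∸ j) + (v ∸ j) ≡ n
twin-split {n} {α₁} {β₁} {α₂} {β₂} α₁≤β₁ α₂≤β₂ parity-β₁ parity-β₂ n≤β α₁≤n+β₂ α₂≤n+β₁ parity-n
  with β₁ ≤? n + β₂ | β₂ ≤? n + β₁
... | yes β₁≤n+β₂ | yes β₂≤n+β₁ =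
  β₁ , β₂ , (α₁≤β₁ , ≤-refl , parity-β₁) , (α₂≤β₂ , ≤-refl , parity-β₂) ,
  pair-off n≤β β₂≤n+β₁ β₁≤n+β₂ (begin
    parity n                    ≡⟨ trans parity-n (ℙ.+-homo-+ α₁ α₂) ⟩
    parity α₁ ℙ+ parity α₂      ≡⟨ cong₂ _ℙ+_ parity-β₁ parity-β₂ ⟨
    parity β₁ ℙ+ parity β₂      ≡⟨ ℙ.+-homo-+ β₁ β₂ ⟨
    parity (β₁ + β₂)            ∎)
  where open ≡-Reasoning
... | yes β₁≤n+β₂ | no β₂≰n+β₁ =
  β₁ , n + β₁ , (α₁≤β₁ , ≤-refl , parity-β₁) , (α₂≤n+β₁ , <⇒≤ (≰⇒> β₂≰n+β₁) , parity-v) ,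
  pair-off (≤-trans (m≤n+m n β₁) (+-monoʳ-≤ β₁ (m≤m+n n β₁))) (≤-reflexive refl)
           (≤-trans (m≤n+m β₁ n) (+-monoʳ-≤ n (m≤n+m β₁ n))) (sym parity-around)
  where
  parity-v : parity (n + β₁) ≡ parity α₂
  parity-v = trans (ℙ.+-homo-+ n β₁)
    (trans (cong₂ _ℙ+_ (trans parity-n (ℙ.+-homo-+ α₁ α₂)) parity-β₁) ([p+q]+p≡q (parity α₁) _))
  parity-around : parity (β₁ + (n + β₁)) ≡ parity n
  parity-around = trans (cong parity (trans (+-comm β₁ (n + β₁)) (+-assoc n β₁ β₁))) (parity-+-double n β₁)
... | no β₁≰n+β₂ | _ =
  n + β₂ , β₂ , (α₁≤n+β₂ , <⇒≤ (≰⇒> β₁≰n+β₂) , parity-u) , (α₂≤β₂ , ≤-refl , parity-β₂) ,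
  pair-off (≤-trans (m≤m+n n β₂) (m≤m+n (n + β₂) β₂)) (≤-trans (m≤n+m β₂ n) (+-monoʳ-≤ n (m≤n+m β₂ n)))
           (≤-reflexive refl) (sym parity-around)
  where
  parity-u : parity (n + β₂) ≡ parity α₁
  parity-u = trans (ℙ.+-homo-+ n β₂)
    (trans (cong₂ _ℙ+_ (trans parity-n (ℙ.+-homo-+ α₁ α₂)) parity-β₂) ([p+q]+q≡p _ _))
  parity-around : parity ((n + β₂) + β₂) ≡ parity n
  parity-around = trans (cong parity (+-assoc n β₂ β₂)) (parity-+-double n β₂)

attach-split : ∀ {n α₁ β₁ α₂ β₂} → α₁ ≤ β₁ → α₂ ≤ β₂ →
  α₁ ∸ β₂ ≤ n → n + α₂ ≤ β₁ → parity n ≡ parity (α₁ + α₂) →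
  ∃ λ j → (n + j) ∈⟦ α₁ , β₁ ⟧ × j ∈⟦ α₂ , β₂ ⟧
attach-split {n} {α₁} {β₁} {α₂} {β₂} α₁≤β₁ α₂≤β₂ α₁∸β₂≤n n+α₂≤β₁ parity-n with α₁ ≤? n + α₂
... | yes α₁≤n+α₂ = α₂ , (α₁≤n+α₂ , n+α₂≤β₁ , parity-u) , (≤-refl , α₂≤β₂ , refl)
  where
  parity-u : parity (n + α₂) ≡ parity α₁
  parity-u = trans (ℙ.+-homo-+ n α₂)
    (trans (cong (_ℙ+ parity α₂) (trans parity-n (ℙ.+-homo-+ α₁ α₂))) ([p+q]+q≡p _ _))
... | no α₁≰n+α₂ =
  α₁ ∸ n , subst (_∈⟦ α₁ , β₁ ⟧) (sym (m+[n∸m]≡n n≤α₁)) (≤-refl , α₁≤β₁ , refl) ,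
  (m+n≤o⇒m≤o∸n α₂ (subst (_≤ α₁) (+-comm n α₂) n+α₂≤α₁) , m≤n+o⇒m∸n≤o α₁ n α₁≤n+β₂ , parity-j)
  where
  n+α₂≤α₁ : n + α₂ ≤ α₁
  n+α₂≤α₁ = <⇒≤ (≰⇒> α₁≰n+α₂)
  n≤α₁ : n ≤ α₁
  n≤α₁ = ≤-trans (m≤m+n n α₂) n+α₂≤α₁
  α₁≤n+β₂ : α₁ ≤ n + β₂
  α₁≤n+β₂ = ≤-trans (m≤n+m∸n α₁ β₂) (≤-trans (+-monoʳ-≤ β₂ α₁∸β₂≤n) (≤-reflexive (+-comm β₂ n)))
  parity-j : parity (α₁ ∸ n) ≡ parity α₂
  parity-j = trans (parity-∸ n≤α₁)
    (trans (cong (parity α₁ ℙ+_) (trans parity-n (ℙ.+-homo-+ α₁ α₂))) (p+[p+q]≡q (parity α₁) _))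

[a+b]∸[x+y]≤[a∸x]+[b∸y] : ∀ a b x y → (a + b) ∸ (x + y) ≤ (a ∸ x) + (b ∸ y)
[a+b]∸[x+y]≤[a∸x]+[b∸y] a b x y = m≤n+o⇒m∸n≤o (a + b) (x + y) (begin
  a + b                          ≤⟨ +-mono-≤ (m≤n+m∸n a x) (m≤n+m∸n b y) ⟩
  (x + (a ∸ x)) + (y + (b ∸ y))  ≡⟨ +-interchange x (a ∸ x) y (b ∸ y) ⟩
  (x + y) + ((a ∸ x) + (b ∸ y))  ∎)
  where open ≤-Reasoning

[a∸b]∸[x+y]≤[a∸[x+j]]+[[y+j]∸b] : ∀ a b x y j → (a ∸ b) ∸ (x + y) ≤ (a ∸ (x + j)) + ((y + j) ∸ b)
[a∸b]∸[x+y]≤[a∸[x+j]]+[[y+j]∸b] a b x y j rewrite ∸-+-assoc a b (x + y) =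
  m≤n+o⇒m∸n≤o a (b + (x + y)) (begin
    a                          ≤⟨ m≤n+m∸n a (x + j) ⟩
    (x + j) + R₁               ≤⟨ +-monoˡ-≤ R₁ (+-monoʳ-≤ x j≤b+R₂) ⟩
    (x + (b + R₂)) + R₁        ≡⟨ rearrange x b R₂ R₁ ⟩
    (b + x) + (R₁ + R₂)        ≤⟨ +-monoˡ-≤ (R₁ + R₂) (+-monoʳ-≤ b (m≤m+n x y)) ⟩
    (b + (x + y)) + (R₁ + R₂)  ∎)
  where
  open ≤-Reasoning
  R₁ R₂ : ℕ
  R₁ = a ∸ (x + j)
  R₂ = (y + j) ∸ b
  j≤b+R₂ : j ≤ b + R₂
  j≤b+R₂ = ≤-trans (m≤n+m j y) (m≤n+m∸n (y + j) b)
  rearrange : ∀ x b r₂ r₁ → (x + (b + r₂)) + r₁ ≡ (b + x) + (r₁ + r₂)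
  rearrange = solve-∀

x∸[b∸a]≤[[x+j]∸b]+[a∸j] : ∀ x j b a → x ∸ (b ∸ a) ≤ ((x + j) ∸ b) + (a ∸ j)
x∸[b∸a]≤[[x+j]∸b]+[a∸j] x j b a = m≤n+o⇒m∸n≤o x (b ∸ a) (+-cancelˡ-≤ a _ _ (begin
  a + x                          ≤⟨ +-monoˡ-≤ x (m≤n+m∸n a j) ⟩
  (j + R₂) + x                   ≡⟨ rearrange j R₂ x ⟩
  (x + j) + R₂                   ≤⟨ +-monoˡ-≤ R₂ (m≤n+m∸n (x + j) b) ⟩
  (b + R₁) + R₂                  ≤⟨ +-monoˡ-≤ R₂ (+-monoˡ-≤ R₁ (m≤n+m∸n b a)) ⟩
  ((a + (b ∸ a)) + R₁) + R₂      ≡⟨ reassociate a (b ∸ a) R₁ R₂ ⟩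
  a + ((b ∸ a) + (R₁ + R₂))      ∎))
  where
  open ≤-Reasoning
  R₁ R₂ : ℕ
  R₁ = (x + j) ∸ b
  R₂ = a ∸ j
  rearrange : ∀ j r₂ x → (j + r₂) + x ≡ (x + j) + r₂
  rearrange = solve-∀
  reassociate : ∀ a d r₁ r₂ → ((a + d) + r₁) + r₂ ≡ a + (d + (r₁ + r₂))
  reassociate = solve-∀

x+[a∸b]≤[[x+j]∸b]+[a∸j] : ∀ x j {b a} → b ≤ a → x + (a ∸ b) ≤ ((x + j) ∸ b) + (a ∸ j)
x+[a∸b]≤[[x+j]∸b]+[a∸j] x j {b} {a} b≤a = +-cancelˡ-≤ b _ _ (begin
  b + (x + (a ∸ b))              ≡⟨ rearrange b x (a ∸ b) ⟩
  x + (b + (a ∸ b))              ≡⟨ cong (x +_) (m+[n∸m]≡n b≤a) ⟩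
  x + a                          ≤⟨ +-monoʳ-≤ x (m≤n+m∸n a j) ⟩
  x + (j + R₂)                   ≡⟨ +-assoc x j R₂ ⟨
  (x + j) + R₂                   ≤⟨ +-monoˡ-≤ R₂ (m≤n+m∸n (x + j) b) ⟩
  (b + R₁) + R₂                  ≡⟨ +-assoc b R₁ R₂ ⟩
  b + (R₁ + R₂)                  ∎)
  where
  open ≤-Reasoning
  R₁ R₂ : ℕ
  R₁ = (x + j) ∸ b
  R₂ = a ∸ j
  rearrange : ∀ b x e → b + (x + e) ≡ x + (b + e)
  rearrange = solve-∀

add-excess : ∀ μ₁ μ₂ {A B Z c₁ c₂} → Z ≤ A + B → μ₁ + A ≤ c₁ → μ₂ + B ≤ c₂ → (μ₁ + μ₂) + Z ≤ c₁ + c₂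
add-excess μ₁ μ₂ {A} {B} Z≤A+B le₁ le₂ =
  ≤-trans (+-monoʳ-≤ (μ₁ + μ₂) Z≤A+B) (≤-trans (≤-reflexive (+-interchange μ₁ μ₂ A B)) (+-mono-≤ le₁ le₂))

round-up-bound : ∀ {μ m α c k} → (∀ {n} → m ≤ n → parity n ≡ parity μ → α ≤ n) →
  μ + (m ∸ k) ≤ c → parity c ≡ parity k → μ + (α ∸ k) ≤ c
round-up-bound {μ} {m} {α} {c} {k} least μ+[m∸k]≤c parity-c =
  subst (μ + (α ∸ k) ≤_) (m+[n∸m]≡n μ≤c) (+-monoʳ-≤ μ (m≤n+o⇒m∸n≤o α k (least m≤k+e parity-k+e)))
  where
  μ≤c : μ ≤ c
  μ≤c = ≤-trans (m≤m+n μ _) μ+[m∸k]≤c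
  e : ℕ
  e = c ∸ μ
  m≤k+e : m ≤ k + e
  m≤k+e = ≤-trans (m≤n+m∸n m k) (+-monoʳ-≤ k (m+n≤o⇒m≤o∸n (m ∸ k) (subst (_≤ c) (+-comm μ _) μ+[m∸k]≤c)))
  parity-k+e : parity (k + e) ≡ parity μ
  parity-k+e = begin
    parity (k + e)                          ≡⟨ ℙ.+-homo-+ k e ⟩
    parity k ℙ+ parity e                    ≡⟨ cong₂ _ℙ+_ (sym parity-c) (parity-∸ μ≤c) ⟩
    parity c ℙ+ (parity c ℙ+ parity μ)      ≡⟨ p+[p+q]≡q (parity c) (parity μ) ⟩
    parity μ                                ∎
    where open ≡-Reasoning

join-achieves : ∀ c {l r xl xr j μ₁ μ₂} → Achieves l (xl + j) μ₁ → Achieves r (xr + j) μ₂ →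
  (c ≡ falseTwin → j ≡ 0) → (c ≡ attach → xr ≡ 0) → (c ≡ attach → 0 < xl + j) →
  Achieves (node c l r) (xl + xr) (μ₁ + μ₂)
join-achieves c {xl = xl} {xr} {j} (Sl , Fl , |Sl|≤μ₁) (Sr , Fr , |Sr|≤μ₂) j≡0 xr≡0 nonempty =
  join Sl Sr ,
  compose c (record { j = j ; xl = xl ; xr = xr ; k≡xl+xr = refl ; feasibleˡ = Fl ; feasibleʳ = Fr
                    ; falseTwin⇒j≡0 = j≡0 ; attach⇒xr≡0 = xr≡0 }) nonempty ,
  +-mono-≤ |Sl|≤μ₁ |Sr|≤μ₂

parity-μ₁+μ₂ : ∀ {l r} (P₁ : Profile l) (P₂ : Profile r) →
  parity (Profile.μ P₁ + Profile.μ P₂) ≡ parity (Profile.α P₁ + Profile.α P₂)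
parity-μ₁+μ₂ P₁ P₂ =
  trans (ℙ.+-homo-+ P₁.μ P₂.μ) (trans (cong₂ _ℙ+_ P₁.parity-μ P₂.parity-μ) (sym (ℙ.+-homo-+ P₁.α P₂.α)))
  where
  module P₁ = Profile P₁
  module P₂ = Profile P₂

profile-leaf : Profile leaf
profile-leaf = record
  { μ        = 0
  ; α        = 0
  ; β        = 0
  ; α≤β      = z≤n
  ; parity-β = refl
  ; achieves = λ { (_ , z≤n , _) → ∅ , ((λ { here () }) , ∅ , (λ _ ()) , refl , (λ x → x) , λ _ ()) , z≤n }
  ; above-α  = λ k S _ → subst (_≤ count leaf S) (sym (0∸n≡0 k)) z≤n
  ; above-β  = λ k S F → feasible⇒≤count leaf F
  }

split-falseTwin : ∀ {l r k S} → Feasible (node falseTwin l r) k S →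
  ∃₂ λ xl xr → k ≡ xl + xr × Feasible l xl (S ∘ inl) × Feasible r xr (S ∘ inr)
split-falseTwin {l} {r} F with decompose falseTwin F
... | record { j = j ; xl = xl ; xr = xr ; k≡xl+xr = k≡ ; feasibleˡ = Fl ; feasibleʳ = Fr ; falseTwin⇒j≡0 = j≡0 }
  with j≡0 refl
... | refl = xl , xr , k≡ , subst (λ n → Feasible l n _) (+-identityʳ xl) Fl ,
                           subst (λ n → Feasible r n _) (+-identityʳ xr) Fr

profile-falseTwin : ∀ {l r} → Profile l → Profile r → Profile (node falseTwin l r)
profile-falseTwin {l} {r} P₁ P₂ = record
  { μ        = P₁.μ + P₂.μ
  ; α        = P₁.α + P₂.α
  ; β        = P₁.β + P₂.β
  ; α≤β      = +-mono-≤ P₁.α≤β P₂.α≤β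
  ; parity-β = trans (ℙ.+-homo-+ P₁.β P₂.β) (trans (cong₂ _ℙ+_ P₁.parity-β P₂.parity-β) (sym (ℙ.+-homo-+ P₁.α P₂.α)))
  ; achieves = achieves
  ; above-α  = above-α
  ; above-β  = above-β
  }
  where
  module P₁ = Profile P₁
  module P₂ = Profile P₂
  achieves : ∀ {n} → n ∈⟦ P₁.α + P₂.α , P₁.β + P₂.β ⟧ → Achieves (node falseTwin l r) n (P₁.μ + P₂.μ)
  achieves n∈ with sum-split P₁.α≤β P₂.α≤β P₁.parity-β n∈
  ... | u , v , u∈ , v∈ , u+v≡n =
    subst (λ n → Achieves _ n _) u+v≡n
      (join-achieves falseTwin (subst (λ n → Achieves l n _) (sym (+-identityʳ u)) (P₁.achieves u∈))
                               (subst (λ n → Achieves r n _) (sym (+-identityʳ v)) (P₂.achieves v∈))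
                               (λ _ → refl) (λ ()) (λ ()))
  above-α : ∀ k → LowerBound (node falseTwin l r) k ((P₁.μ + P₂.μ) + ((P₁.α + P₂.α) ∸ k))
  above-α k S F with split-falseTwin F
  ... | xl , xr , refl , Fl , Fr =
    add-excess P₁.μ P₂.μ ([a+b]∸[x+y]≤[a∸x]+[b∸y] P₁.α P₂.α xl xr) (P₁.above-α xl _ Fl) (P₂.above-α xr _ Fr)
  above-β : ∀ k → LowerBound (node falseTwin l r) k ((P₁.μ + P₂.μ) + (k ∸ (P₁.β + P₂.β)))
  above-β k S F with split-falseTwin F
  ... | xl , xr , refl , Fl , Fr =
    add-excess P₁.μ P₂.μ ([a+b]∸[x+y]≤[a∸x]+[b∸y] xl xr P₁.β P₂.β) (P₁.above-β xl _ Fl) (P₂.above-β xr _ Fr)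

module TrueTwin {l r} (P₁ : Profile l) (P₂ : Profile r) where
  module P₁ = Profile P₁
  module P₂ = Profile P₂

  μ β m : ℕ
  μ = P₁.μ + P₂.μ
  β = P₁.β + P₂.β
  m = (P₁.α ∸ P₂.β) ⊔ (P₂.α ∸ P₁.β)
  open LeastAbove (least-above m (parity μ)) renaming (value to α)

  parity-β≡μ : parity β ≡ parity μ
  parity-β≡μ = trans (ℙ.+-homo-+ P₁.β P₂.β)
    (trans (cong₂ _ℙ+_ P₁.parity-β P₂.parity-β) (trans (sym (ℙ.+-homo-+ P₁.α P₂.α)) (sym (parity-μ₁+μ₂ P₁ P₂))))

  m≤β : m ≤ β
  m≤β = ⊔-lub (≤-trans (m∸n≤m P₁.α P₂.β) (≤-trans P₁.α≤β (m≤m+n P₁.β P₂.β)))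
              (≤-trans (m∸n≤m P₂.α P₁.β) (≤-trans P₂.α≤β (m≤n+m P₂.β P₁.β)))

  achieves : ∀ {n} → n ∈⟦ α , β ⟧ → Achieves (node trueTwin l r) n μ
  achieves {n} (α≤n , n≤β , parity-n)
    with twin-split P₁.α≤β P₂.α≤β P₁.parity-β P₂.parity-β n≤β
           (reach (m≤m⊔n _ _)) (reach (m≤n⊔m (P₁.α ∸ P₂.β) _))
           (trans parity-n (trans parity-value (parity-μ₁+μ₂ P₁ P₂)))
    where
    m≤n : m ≤ n
    m≤n = ≤-trans m≤value α≤n
    reach : ∀ {a b} → a ∸ b ≤ m → a ≤ n + b
    reach {a} {b} a∸b≤m = ≤-trans (m≤n+m∸n a b) (≤-trans (+-monoʳ-≤ b (≤-trans a∸b≤m m≤n)) (≤-reflexive (+-comm b n)))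
  ... | u , v , u∈ , v∈ , j , j≤u , j≤v , xl+xr≡n =
    subst (λ n → Achieves _ n μ) xl+xr≡n
      (join-achieves trueTwin {xl = u ∸ j} {v ∸ j} {j}
                              (subst (λ n → Achieves l n _) (sym (m∸n+n≡m j≤u)) (P₁.achieves u∈))
                              (subst (λ n → Achieves r n _) (sym (m∸n+n≡m j≤v)) (P₂.achieves v∈))
                              (λ ()) (λ ()) (λ ()))

  above-α : ∀ k → LowerBound (node trueTwin l r) k (μ + (α ∸ k))
  above-α k S F = round-up-bound {μ} {k = k} least μ+[m∸k]≤ (feasible-parity _ F)
    where
    μ+[m∸k]≤ : μ + (m ∸ k) ≤ count (node trueTwin l r) S
    μ+[m∸k]≤ with decompose trueTwin F
    ... | record { j = j ; xl = xl ; xr = xr ; k≡xl+xr = refl ; feasibleˡ = Fl ; feasibleʳ = Fr } =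
      subst (_≤ _) (sym (trans (cong (μ +_) (∸-distribʳ-⊔ (xl + xr) (P₁.α ∸ P₂.β) (P₂.α ∸ P₁.β)))
                               (+-distribˡ-⊔ μ _ _)))
        (⊔-lub (add-excess P₁.μ P₂.μ ([a∸b]∸[x+y]≤[a∸[x+j]]+[[y+j]∸b] P₁.α P₂.β xl xr j)
                           (P₁.above-α _ _ Fl) (P₂.above-β _ _ Fr))
               (add-excess P₁.μ P₂.μ mirrored (P₁.above-β _ _ Fl) (P₂.above-α _ _ Fr)))
      where
      mirrored : (P₂.α ∸ P₁.β) ∸ (xl + xr) ≤ ((xl + j) ∸ P₁.β) + (P₂.α ∸ (xr + j))
      mirrored = subst₂ _≤_ (cong ((P₂.α ∸ P₁.β) ∸_) (+-comm xr xl)) (+-comm (P₂.α ∸ (xr + j)) ((xl + j) ∸ P₁.β))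
                   ([a∸b]∸[x+y]≤[a∸[x+j]]+[[y+j]∸b] P₂.α P₁.β xr xl j)

  above-β : ∀ k → LowerBound (node trueTwin l r) k (μ + (k ∸ β))
  above-β k S F with decompose trueTwin F
  ... | record { j = j ; xl = xl ; xr = xr ; k≡xl+xr = refl ; feasibleˡ = Fl ; feasibleʳ = Fr } =
    add-excess P₁.μ P₂.μ
      (≤-trans (∸-monoˡ-≤ β (+-mono-≤ (m≤m+n xl j) (m≤m+n xr j)))
               ([a+b]∸[x+y]≤[a∸x]+[b∸y] (xl + j) (xr + j) P₁.β P₂.β))
      (P₁.above-β _ _ Fl) (P₂.above-β _ _ Fr)

  profile : Profile (node trueTwin l r)
  profile = record
    { μ        = μ
    ; α        = α
    ; β        = β
    ; α≤β      = least m≤β parity-β≡μ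
    ; parity-β = trans parity-β≡μ (sym parity-value)
    ; achieves = achieves
    ; above-α  = above-α
    ; above-β  = above-β
    }

perfectMatching? : ∀ t (W : Subset t) → Dec (PerfectMatching t W)
perfectMatching? t W = go (count t W) W ≤-refl
  where
  go : ∀ n W → count t W ≤ n → Dec (PerfectMatching t W)
  go n W |W|≤n with anyVtx? t (λ x → W x Bool.≟ true)
  ... | no empty = yes ((λ x → x) , λ x Wx → contradiction (x , Wx) empty)
  ... | yes (x , Wx) with n
  ...   | zero = contradiction (≤-trans (≤-reflexive (count-delete t W x Wx)) |W|≤n) λ ()
  ...   | suc n′ = map′ extend restrict
                     (anyVtx? t λ y → ((W y Bool.≟ true) ×-dec edge? t x y) ×-dec go n′ (remove₂ W x y) (smaller y))
    where
    smaller : ∀ y → count t (remove₂ W x y) ≤ n′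
    smaller y = ≤-pred (begin
      suc (count t (remove₂ W x y))       ≤⟨ s≤s (count-mono t (update-false-⊆ (update W x false) y)) ⟩
      suc (count t (update W x false))    ≡⟨ count-delete t W x Wx ⟩
      count t W                           ≤⟨ |W|≤n ⟩
      suc n′                              ∎)
      where open ≤-Reasoning
    extend : (∃ λ y → (W y ≡ true × Edge t x y) × PerfectMatching t (remove₂ W x y)) → PerfectMatching t W
    extend (y , (Wy , xy) , m , M) =
      m [ x ↔ y ] , matches-cong t restored
        (matches-insert₂ t M xy (trans (update-≢ (update W x false) false (edge⇒≢ t xy)) (update-≡ W x false))
                                (update-≡ (update W x false) y false))
      where
      restored : insert₂ (remove₂ W x y) x y ≗ W
      restored z with z ≟ᵥ y | z ≟ᵥ x
      ... | yes refl | _        = sym Wy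
      ... | no _     | yes refl = sym Wx
      ... | no _     | no _     = refl
    restrict : PerfectMatching t W → ∃ λ y → (W y ≡ true × Edge t x y) × PerfectMatching t (remove₂ W x y)
    restrict (m , M) = m x , (proj₁ (M x Wx) , proj₁ (proj₂ (M x Wx))) , m , matches-remove₂ t M Wx

anySubset? : ∀ t {P : Subset t → Set} → (∀ {A B} → A ≗ B → P A → P B) →
  (∀ S → Dec (P S)) → Dec (∃ P)
anySubset? leaf {P} respects P? =
  map′ [ (λ p → _ , p) , (λ p → _ , p) ] from (P? (λ _ → true) ⊎-dec P? (λ _ → false))
  where
  from : ∃ P → P (λ _ → true) ⊎ P (λ _ → false)
  from (S , p) with S here in Sx
  ... | true  = inj₁ (respects (λ { here → Sx }) p)
  ... | false = inj₂ (respects (λ { here → Sx }) p)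
anySubset? (node c l r) {P} respects P? =
  map′ (λ { (A , B , p) → join A B , p }) (λ { (S , p) → S ∘ inl , S ∘ inr , respects split p })
       (anySubset? l (λ A≗A′ (B , p) → B , respects (join-congˡ A≗A′) p)
          λ A → anySubset? r (λ B≗B′ → respects (join-congʳ B≗B′)) λ B → P? (join A B))
  where
  split : ∀ {S : Subset (node c l r)} → S ≗ join (S ∘ inl) (S ∘ inr)
  split (inl x) = refl
  split (inr y) = refl
  join-congˡ : ∀ {A A′ B} → A ≗ A′ → join {c} A B ≗ join A′ B
  join-congˡ A≗A′ (inl x) = A≗A′ x
  join-congˡ A≗A′ (inr y) = refl
  join-congʳ : ∀ {A B B′} → B ≗ B′ → join {c} A B ≗ join A B′
  join-congʳ B≗B′ (inl x) = refl
  join-congʳ B≗B′ (inr y) = B≗B′ y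

dominates? : ∀ t (S : Subset t) → Dec (Dominates t S)
dominates? t S = allVtx? t λ x → (TS t x Bool.≟ false) →-dec
  anyVtx? t (λ y → (S y Bool.≟ true) ×-dec ((y ≟ᵥ x) ⊎-dec edge? t y x))

dominates-cong : ∀ t {S S′ : Subset t} → S ≗ S′ → Dominates t S → Dominates t S′
dominates-cong t S≗S′ = dominates-⊆ t (λ x Sx → trans (sym (S≗S′ x)) Sx)

achieves₀? : ∀ t n → Dec (Achieves t 0 n)
achieves₀? t n =
  map′ to from (anySubset? t respects λ S → dominates? t S ×-dec perfectMatching? t S ×-dec (count t S ≤? n))
  where
  respects : ∀ {A B} → A ≗ B → Dominates t A × PerfectMatching t A × count t A ≤ n →
    Dominates t B × PerfectMatching t B × count t B ≤ n
  respects A≗B (dom , (m , M) , ≤n) =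
    dominates-cong t A≗B dom , (m , matches-cong t A≗B M) , subst (_≤ n) (count-cong t A≗B) ≤n
  to : (∃ λ S → Dominates t S × PerfectMatching t S × count t S ≤ n) → Achieves t 0 n
  to (S , dom , (m , M) , ≤n) =
    S , (dom , ∅ , (λ _ ()) , count-∅ t , m , matches-cong t (λ x → sym (∧-identityʳ (S x))) M) , ≤n
  from : Achieves t 0 n → ∃ λ S → Dominates t S × PerfectMatching t S × count t S ≤ n
  from (S , (dom , X , _ , |X| , m , M) , ≤n) = S , dom , (m , matches-cong t S∖X≗S M) , ≤n
    where
    S∖X≗S : S ∖ X ≗ S
    S∖X≗S x rewrite count≡0⇒empty t |X| x = ∧-identityʳ (S x)

parity-gap : ∀ {a b} → a < b → parity a ≡ parity b → suc a < b
parity-gap {a} a<b parity-a = ≤∧≢⇒< a<b λ { refl → parity-suc-≢ a (sym parity-a) }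

γ₀-gap : ∀ t {μ} → parity μ ≡ 0ℙ → ¬ Achieves t 0 μ → LowerBound t 0 (suc (suc μ))
γ₀-gap t parity-μ ¬A₀ S F =
  parity-gap (≰⇒> λ |S|≤μ → ¬A₀ (S , F , |S|≤μ)) (trans parity-μ (sym (feasible-parity t F)))

-- Joining at a ⊕ node needs a twin on the left to dominate the twins of r, so for α = 0 the value
-- γ̂₀ ∈ {μ, μ + 2} is not determined by the children; it is decided by exhaustive search.
profile-from-positive : ∀ t {μ α β} → α ≤ β → parity β ≡ parity α → parity μ ≡ parity α →
  (∀ {n} → n ∈⟦ α , β ⟧ → 0 < n → Achieves t n μ) → (α ≡ 0 → β ≡ 0 → Achieves t 1 (suc μ)) →
  (∀ k → LowerBound t k (μ + (α ∸ k))) → (∀ k → LowerBound t k (μ + (k ∸ β))) → Profile t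
profile-from-positive t {μ} {suc α} {β} α≤β parity-β _ achieves-pos _ above-α above-β = record
  { μ = μ ; α = suc α ; β = β ; α≤β = α≤β ; parity-β = parity-β
  ; achieves = λ n∈ → achieves-pos n∈ (≤-trans (s≤s z≤n) (proj₁ n∈))
  ; above-α = above-α ; above-β = above-β }
profile-from-positive t {μ} {zero} {β} α≤β parity-β parity-μ achieves-pos achieves-one above-α above-β
  with achieves₀? t μ
... | yes A₀ = record
  { μ = μ ; α = 0 ; β = β ; α≤β = α≤β ; parity-β = parity-β
  ; achieves = λ { {zero} _ → A₀ ; {suc n} n∈ → achieves-pos n∈ (s≤s z≤n) }
  ; above-α = above-α ; above-β = above-β }
... | no ¬A₀ with β
...   | zero = record
  { μ = suc μ ; α = 1 ; β = 1 ; α≤β = ≤-refl ; parity-β = refl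
  ; achieves = λ { (s≤s z≤n , s≤s z≤n , _) → achieves-one refl refl }
  ; above-α = λ { zero S F → subst (_≤ count t S) (+-comm 1 (suc μ)) (γ₀-gap t parity-μ ¬A₀ S F)
                ; (suc k) S F → ≤-trans (≤-reflexive (trans (cong (suc μ +_) (0∸n≡0 k)) (+-identityʳ (suc μ))))
                                        (≤-trans (s≤s (m≤m+n μ k))
                                                 (≤-trans (≤-reflexive (sym (+-suc μ k))) (above-β (suc k) S F))) }
  ; above-β = λ { zero S F → ≤-trans (≤-reflexive (+-identityʳ (suc μ))) (<⇒≤ (γ₀-gap t parity-μ ¬A₀ S F))
                ; (suc k) S F → subst (_≤ count t S) (+-suc μ k) (above-β (suc k) S F) }
  }
...   | suc zero = contradiction parity-β λ ()
...   | suc (suc β′) = record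
  { μ = μ ; α = 2 ; β = suc (suc β′) ; α≤β = s≤s (s≤s z≤n) ; parity-β = parity-β
  ; achieves = λ { n∈@(_ , n≤β , parity-n) → achieves-pos (z≤n , n≤β , parity-n) (≤-trans (s≤s z≤n) (proj₁ n∈)) }
  ; above-α = λ { zero S F → subst (_≤ count t S) (+-comm 2 μ) (γ₀-gap t parity-μ ¬A₀ S F)
                ; (suc zero) S F → subst (_≤ count t S) (+-comm 1 μ) (odd S F)
                ; (suc (suc k)) S F → subst (λ e → μ + e ≤ count t S) (sym (0∸n≡0 k)) (above-α _ S F) }
  ; above-β = above-β }
  where
  odd : ∀ S → Feasible t 1 S → suc μ ≤ count t S
  odd S F = ≤∧≢⇒< (subst (_≤ count t S) (+-identityʳ μ) (above-α 1 S F))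
                  λ μ≡|S| → parity-suc-≢ 0
                              (trans (sym (feasible-parity t F)) (trans (cong parity (sym μ≡|S|)) parity-μ))

split-attach : ∀ {l r k S} → Feasible (node attach l r) k S →
  ∃₂ λ j xl → k ≡ xl × Feasible l (xl + j) (S ∘ inl) × Feasible r j (S ∘ inr)
split-attach F with decompose attach F
... | record { j = j ; xl = xl ; xr = xr ; k≡xl+xr = k≡ ; feasibleˡ = Fl ; feasibleʳ = Fr ; attach⇒xr≡0 = xr≡0 }
  with xr≡0 refl
... | refl = j , xl , trans k≡ (+-identityʳ xl) , Fl , Fr

tsSize-pos : ∀ t → 0 < tsSize t
tsSize-pos leaf                 = s≤s z≤n
tsSize-pos (node trueTwin  l r) = ≤-trans (tsSize-pos l) (m≤m+n _ _)
tsSize-pos (node falseTwin l r) = ≤-trans (tsSize-pos l) (m≤m+n _ _)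
tsSize-pos (node attach    l r) = ≤-trans (tsSize-pos l) (m≤m+n _ _)

-- k = 1: one twin of l stays a twin of the node, all twins of r are matched to twins of l
attach-achieves-one : ∀ {l r} (P₁ : Profile l) (P₂ : Profile r) → let module P₁ = Profile P₁; module P₂ = Profile P₂ in
  P₁.β ≤ P₂.α → Achieves (node attach l r) 1 (suc (P₁.μ + P₂.μ + (P₂.α ∸ P₁.β)))
attach-achieves-one {l} {r} P₁ P₂ = from-left (Profile.β P₁) (Profile.achieves P₁ (Profile.β∈ P₁))
  where
  module P₁ = Profile P₁
  module P₂ = Profile P₂
  right-at : ∀ b → b ≤ P₂.α → Achieves r b ((P₂.α ∸ b) + P₂.μ)
  right-at b b≤α₂ = down-by r (P₂.α ∸ b) (subst (λ n → Achieves r n P₂.μ) (sym (m∸n+n≡m b≤α₂)) (P₂.achieves P₂.α∈))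
  from-left : ∀ β₁ → Achieves l β₁ P₁.μ → β₁ ≤ P₂.α → Achieves (node attach l r) 1 (suc (P₁.μ + P₂.μ + (P₂.α ∸ β₁)))
  from-left zero A _ = achieves-≤ (node attach l r) (≤-reflexive (cong suc (rearrange P₁.μ P₂.μ P₂.α)))
    (join-achieves attach {xl = 1} {0} {0} (up-by l 1 (tsSize-pos l) A) (right-at 0 z≤n)
                   (λ ()) (λ _ → refl) (λ _ → s≤s z≤n))
    where
    rearrange : ∀ a b c → a + (c + b) ≡ a + b + c
    rearrange = solve-∀
  from-left (suc b) A b<α₂ =
    achieves-≤ (node attach l r)
      (≤-reflexive (trans (cong (λ e → P₁.μ + (e + P₂.μ)) (+-∸-assoc 1 b<α₂)) (rearrange P₁.μ P₂.μ (P₂.α ∸ suc b))))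
      (join-achieves attach {xl = 1} {0} {b} A (right-at b (≤-trans (n≤1+n b) b<α₂))
                     (λ ()) (λ _ → refl) (λ _ → s≤s z≤n))
    where
    rearrange : ∀ a b c → a + (suc c + b) ≡ suc (a + b + c)
    rearrange = solve-∀

module AttachOverlapping {l r} (P₁ : Profile l) (P₂ : Profile r) (α₂≤β₁ : Profile.α P₂ ≤ Profile.β P₁) where
  module P₁ = Profile P₁
  module P₂ = Profile P₂

  μ β m : ℕ
  μ = P₁.μ + P₂.μ
  β = P₁.β ∸ P₂.α
  m = P₁.α ∸ P₂.β
  open LeastAbove (least-above m (parity μ)) renaming (value to α)

  parity-β≡μ : parity β ≡ parity μ
  parity-β≡μ = trans (parity-∸ α₂≤β₁)
    (trans (cong (_ℙ+ parity P₂.α) P₁.parity-β) (trans (sym (ℙ.+-homo-+ P₁.α P₂.α)) (sym (parity-μ₁+μ₂ P₁ P₂))))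

  α≤β : α ≤ β
  α≤β = least (∸-mono P₁.α≤β P₂.α≤β) parity-β≡μ

  achieves-pos : ∀ {n} → n ∈⟦ α , β ⟧ → 0 < n → Achieves (node attach l r) n μ
  achieves-pos {n} (α≤n , n≤β , parity-n) 0<n
    with attach-split P₁.α≤β P₂.α≤β (≤-trans m≤value α≤n) (m≤o∸n⇒m+n≤o n α₂≤β₁ n≤β)
           (trans parity-n (trans parity-value (parity-μ₁+μ₂ P₁ P₂)))
  ... | j , u∈ , j∈ =
    subst (λ n → Achieves _ n μ) (+-identityʳ n)
      (join-achieves attach {xl = n} {0} {j} (P₁.achieves u∈) (P₂.achieves j∈)
        (λ ()) (λ _ → refl) (λ _ → ≤-trans 0<n (m≤m+n n j)))

  achieves-one : α ≡ 0 → β ≡ 0 → Achieves (node attach l r) 1 (suc μ)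
  achieves-one _ β≡0 =
    subst (λ e → Achieves (node attach l r) 1 (suc e)) (trans (cong (μ +_) (m≤n⇒m∸n≡0 α₂≤β₁)) (+-identityʳ μ))
      (attach-achieves-one P₁ P₂ (m∸n≡0⇒m≤n β≡0))

  above-α : ∀ k → LowerBound (node attach l r) k (μ + (α ∸ k))
  above-α k S F = round-up-bound {μ} {k = k} least μ+[m∸k]≤ (feasible-parity _ F)
    where
    μ+[m∸k]≤ : μ + (m ∸ k) ≤ count (node attach l r) S
    μ+[m∸k]≤ with split-attach F
    ... | j , xl , refl , Fl , Fr =
      add-excess P₁.μ P₂.μ
        (subst (λ x → m ∸ x ≤ (P₁.α ∸ (xl + j)) + (j ∸ P₂.β)) (+-identityʳ xl)
               ([a∸b]∸[x+y]≤[a∸[x+j]]+[[y+j]∸b] P₁.α P₂.β xl 0 j))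
        (P₁.above-α _ _ Fl) (P₂.above-β _ _ Fr)

  above-β : ∀ k → LowerBound (node attach l r) k (μ + (k ∸ β))
  above-β k S F with split-attach F
  ... | j , xl , refl , Fl , Fr =
    add-excess P₁.μ P₂.μ (x∸[b∸a]≤[[x+j]∸b]+[a∸j] xl j P₁.β P₂.α) (P₁.above-β _ _ Fl) (P₂.above-α _ _ Fr)

  profile : Profile (node attach l r)
  profile =
    profile-from-positive (node attach l r) α≤β (trans parity-β≡μ (sym parity-value)) (sym parity-value)
      achieves-pos achieves-one above-α above-β

module AttachSeparated {l r} (P₁ : Profile l) (P₂ : Profile r) (β₁≤α₂ : Profile.β P₁ ≤ Profile.α P₂) where
  module P₁ = Profile P₁
  module P₂ = Profile P₂

  μ : ℕ
  μ = P₁.μ + P₂.μ + (P₂.α ∸ P₁.β)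

  parity-μ : parity μ ≡ 0ℙ
  parity-μ = begin
    parity μ
      ≡⟨ ℙ.+-homo-+ (P₁.μ + P₂.μ) _ ⟩
    parity (P₁.μ + P₂.μ) ℙ+ parity (P₂.α ∸ P₁.β)
      ≡⟨ cong₂ _ℙ+_ (trans (parity-μ₁+μ₂ P₁ P₂) (ℙ.+-homo-+ P₁.α P₂.α)) (parity-∸ β₁≤α₂) ⟩
    (parity P₁.α ℙ+ parity P₂.α) ℙ+ (parity P₂.α ℙ+ parity P₁.β)
      ≡⟨ cong (λ p → (parity P₁.α ℙ+ parity P₂.α) ℙ+ (parity P₂.α ℙ+ p)) P₁.parity-β ⟩
    (parity P₁.α ℙ+ parity P₂.α) ℙ+ (parity P₂.α ℙ+ parity P₁.α)
      ≡⟨ [p+q]+[q+p]≡0ℙ (parity P₁.α) (parity P₂.α) ⟩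
    0ℙ
      ∎
    where open ≡-Reasoning

  above-β : ∀ k → LowerBound (node attach l r) k (μ + (k ∸ 0))
  above-β k S F with split-attach F
  ... | j , xl , refl , Fl , Fr =
    subst (_≤ count l (S ∘ inl) + count r (S ∘ inr)) (rearrange P₁.μ P₂.μ xl (P₂.α ∸ P₁.β))
      (add-excess P₁.μ P₂.μ (x+[a∸b]≤[[x+j]∸b]+[a∸j] xl j β₁≤α₂) (P₁.above-β _ _ Fl) (P₂.above-α _ _ Fr))
    where
    rearrange : ∀ a b x e → (a + b) + (x + e) ≡ (a + b + e) + x
    rearrange = solve-∀

  above-α : ∀ k → LowerBound (node attach l r) k (μ + (0 ∸ k))
  above-α k S F =
    ≤-trans (≤-reflexive (trans (cong (μ +_) (0∸n≡0 k)) (+-identityʳ μ))) (≤-trans (m≤m+n μ k) (above-β k S F))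

  profile : Profile (node attach l r)
  profile =
    profile-from-positive (node attach l r) {μ} {0} {0} z≤n refl parity-μ
      (λ n∈ 0<n → contradiction (≤-trans 0<n (proj₁ (proj₂ n∈))) λ ())
      (λ _ _ → attach-achieves-one P₁ P₂ β₁≤α₂) above-α above-β

profile-attach : ∀ {l r} → Profile l → Profile r → Profile (node attach l r)
profile-attach P₁ P₂ with Profile.α P₂ ≤? Profile.β P₁
... | yes α₂≤β₁ = AttachOverlapping.profile P₁ P₂ α₂≤β₁
... | no  α₂≰β₁ = AttachSeparated.profile P₁ P₂ (<⇒≤ (≰⇒> α₂≰β₁))

profile : ∀ t → Profile t
profile leaf                 = profile-leaf
profile (node trueTwin  l r) = TrueTwin.profile (profile l) (profile r)
profile (node falseTwin l r) = profile-falseTwin (profile l) (profile r)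
profile (node attach    l r) = profile-attach    (profile l) (profile r)

lemma3 : (T : Tree) (v : Pos T) (c : Label) (l r : Tree) →
    subtree T v ≡ node c l r →
    (μ a b : ℕ) →
    IsMin (node c l r) μ → IsAlpha (node c l r) μ a → IsBeta (node c l r) μ b →
    (k : ℕ) → k ≤ tsSize (node c l r) →
    (k ≤ a → Gamma (node c l r) k (μ + (a ∸ k))) ×
    (b ≤ k → Gamma (node c l r) k (μ + (k ∸ b))) ×
    (a < k → k < b → (k ∸ a) % 2 ≡ 0 → Gamma (node c l r) k μ) ×
    (a < k → k < b → (k ∸ a) % 2 ≡ 1 → Gamma (node c l r) k (suc μ))
lemma3 _ _ c l r _ μ a b isMin isα isβ = Profile.gamma-profile (profile (node c l r)) isMin isα isβ
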